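{- Let $N\geq 1$ be a natural number and $G$ a 2-connected graph with vertices $x,y$ such that $d(x)=d(y)=2$ and $d(v)=3$ for all $v\in V(G)\setminus\{x,y\}$. Suppose that $G$ contains no $x-y$ path whose length is divisible by 3. Let $G'=G\otimes_N G$ and let $G_1$ and $G_2$ denote the two disjoint copies of $G$ in $G'$. If $C$ is a cycle in $G'$ whose length is divisible by 3, then either $C$ is a cycle in $G_1$ or in $G_2$, or $C$ has length $6N+4+p_1+p_2$ where $p_1$ and $p_2$ are lengths of $x-y$ paths in $G$.
   Context: All graphs are finite and simple. A cross-ladder of length $3N$ ($N\geq1$) is the graph consisting of a path $u_0u_1\cdots u_{3N-1}u_{3N}v_{3N}v_{3N-1}\cdots v_1v_0$ together with the edges $u_{3i}v_{3i}$, $u_{3i+1}v_{3i+2}$, $u_{3i+2}v_{3i+1}$ for every $i\in\{0,\dots,N-1\}$. Given 2-connected graphs $G_1,G_2$ with vertices $x_i,y_i\in V(G_i)$ of degree 2 such that all other vertices of $G_i$ have degree 3 ($i=1,2$), the graph $G_1\otimes_N G_2$ is obtained from the disjoint union of $G_1$, $G_2$ and a cross-ladder $L$ of length $3N$ by adding the edges $x_1u_0$, $y_1v_0$, $x_2u_{3N}$, $y_2v_{3N}$. In $G\otimes_N G$, the two copies $G_1,G_2$ of $G$ play these roles with $x_i,y_i$ the copies of $x,y$. -}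

module Defs where

open import Data.Nat using (ℕ; zero; suc; _+_; _*_; _≤_; _<_)
open import Data.Fin using (Fin; toℕ; fromℕ) renaming (zero to fzero)
open import Data.Bool using (Bool; true; false; T)
open import Data.List using (List; []; _∷_; _∷ʳ_; length; filterᵇ; allFin)
open import Data.List.Relation.Unary.Linked using (Linked)
open import Data.List.Relation.Unary.All using (All)
open import Data.List.Relation.Unary.Unique.Propositional using (Unique)
open import Data.Product using (Σ; ∃; _×_; _,_)
open import Data.Sum using (_⊎_; inj₁; inj₂)
open import Relation.Binary.PropositionalEquality using (_≡_; _≢_)

module _ {V : Set} (R : V → V → Set) where

  record Path (a b : V) : Set where
    constructor mkPath
    field
      inner  : List V
      linked : Linked R (a ∷ inner ∷ʳ b)
      unique : Unique (a ∷ inner ∷ʳ b)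

  pathLength : ∀ {a b} → Path a b → ℕ
  pathLength p = suc (length (Path.inner p))

  pathVertices : ∀ {a b} → Path a b → List V
  pathVertices {a} {b} p = a ∷ Path.inner p ∷ʳ b

  record Cycle : Set where
    constructor mkCycle
    field
      first   : V
      mid     : List V
      lastv   : V
      midNE   : 1 ≤ length mid
      linked  : Linked R (first ∷ mid ∷ʳ lastv)
      unique  : Unique (first ∷ mid ∷ʳ lastv)
      closing : R lastv first

  cycleVertices : Cycle → List V
  cycleVertices c = Cycle.first c ∷ Cycle.mid c ∷ʳ Cycle.lastv c

  -- length (= number of vertices = number of edges)
  cycleLength : Cycle → ℕ
  cycleLength c = suc (suc (length (Cycle.mid c)))

record Graph (n : ℕ) : Set where
  field
    adj    : Fin n → Fin n → Bool
    sym    : ∀ a b → adj a b ≡ adj b a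
    irrefl : ∀ a → adj a a ≡ false

module _ {n : ℕ} (G : Graph n) where
  open Graph G

  Adj : Fin n → Fin n → Set
  Adj a b = T (adj a b)

  degree : Fin n → ℕ
  degree v = length (filterᵇ (adj v) (allFin n))

  Connected : Set
  Connected = ∀ u v → u ≡ v ⊎ Path Adj u v

  ConnectedWithout : Fin n → Set
  ConnectedWithout z = ∀ u v → u ≢ z → v ≢ z →
    u ≡ v ⊎ Σ (Path Adj u v) (λ p → All (_≢ z) (pathVertices Adj p))

  TwoConnected : Set
  TwoConnected = 3 ≤ n × Connected × (∀ z → ConnectedWithout z)

-- Cross-ladder of length 3N: vertices (false , i) = u_i, (true , i) = v_i,
-- for i ∈ {0,…,3N}.

LVertex : ℕ → Set
LVertex N = Bool × Fin (suc (3 * N))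

data LEdge (N : ℕ) : LVertex N → LVertex N → Set where
  -- the path u_0 … u_{3N} v_{3N} … v_0
  rail : ∀ b (i j : Fin (suc (3 * N))) → toℕ j ≡ suc (toℕ i) →
         LEdge N (b , i) (b , j)
  top  : ∀ (i j : Fin (suc (3 * N))) → toℕ i ≡ 3 * N → toℕ j ≡ 3 * N →
         LEdge N (false , i) (true , j)
  rung0 : ∀ k (i j : Fin (suc (3 * N))) → k < N →
          toℕ i ≡ 3 * k → toℕ j ≡ 3 * k → LEdge N (false , i) (true , j)
  rung1 : ∀ k (i j : Fin (suc (3 * N))) → k < N →
          toℕ i ≡ 3 * k + 1 → toℕ j ≡ 3 * k + 2 → LEdge N (false , i) (true , j)
  rung2 : ∀ k (i j : Fin (suc (3 * N))) → k < N →
          toℕ i ≡ 3 * k + 2 → toℕ j ≡ 3 * k + 1 → LEdge N (false , i) (true , j)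

-- G ⊗_N G : vertices inj₁ a (copy G_1), inj₂ (inj₁ a) (copy G_2),
-- inj₂ (inj₂ w) (cross-ladder).

TVertex : ℕ → ℕ → Set
TVertex n N = Fin n ⊎ (Fin n ⊎ LVertex N)

module _ {n : ℕ} (G : Graph n) (x y : Fin n) (N : ℕ) where

  u₀ v₀ u₃ₙ v₃ₙ : TVertex n N
  u₀  = inj₂ (inj₂ (false , fzero))
  v₀  = inj₂ (inj₂ (true , fzero))
  u₃ₙ = inj₂ (inj₂ (false , fromℕ (3 * N)))
  v₃ₙ = inj₂ (inj₂ (true , fromℕ (3 * N)))

  data TEdge : TVertex n N → TVertex n N → Set where
    in₁   : ∀ a b → Adj G a b → TEdge (inj₁ a) (inj₁ b)
    in₂   : ∀ a b → Adj G a b → TEdge (inj₂ (inj₁ a)) (inj₂ (inj₁ b))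
    ladder : ∀ w w' → LEdge N w w' → TEdge (inj₂ (inj₂ w)) (inj₂ (inj₂ w'))
    x₁u₀  : TEdge (inj₁ x) u₀
    y₁v₀  : TEdge (inj₁ y) v₀
    x₂u₃ₙ : TEdge (inj₂ (inj₁ x)) u₃ₙ
    y₂v₃ₙ : TEdge (inj₂ (inj₁ y)) v₃ₙ

  TAdj : TVertex n N → TVertex n N → Set
  TAdj a b = TEdge a b ⊎ TEdge b a

InG₁ : ∀ {n N} → TVertex n N → Set
InG₁ {n} v = ∃ λ (a : Fin n) → v ≡ inj₁ a

InG₂ : ∀ {n N} → TVertex n N → Set
InG₂ {n} v = ∃ λ (a : Fin n) → v ≡ inj₂ (inj₁ a)

-- Let ν c be the number of vertices of C in column c of the ladder. Only x₁u₀ and y₁v₀ join G₁ to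
-- the rest, only x₂u₃ₙ and y₂v₃ₙ join G₂, and between columns c and c + 1 with c ≢ 1 (mod 3) only
-- the two rails cross; a cycle meeting both sides of such a two-edge cut uses both edges. So the
-- part of C inside a copy of G is an x–y path p of G, with |p| + 1 vertices, and a cycle through
-- both copies fills every column, which gives the length (|p₁| + 1) + (|p₂| + 1) + 2(3N + 1).
-- Otherwise the columns met by C form an interval m₀ … m₁ of full columns except possibly the two
-- ends, and the rungs near the ends force 3 ∣ ν m₀ + 1 + m₀ and 3 ∣ ν m₁ + 1 + 2 m₁: the ladder
-- part has ≡ 2 (mod 3) vertices unless m₀ = m₁, or m₁ = m₀ + 1 and it has 4. A cycle inside the
-- ladder thus never has length ≡ 0, and one through a single copy has length |p| + 1 + (≡ 2),
-- divisible by 3 only if |p| is.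

module Submission where

open import Defs
open import Data.Nat using (ℕ; zero; suc; _+_; _*_; _≤_; _<_; _∸_; z≤n; s≤s; s≤s⁻¹; _≟_; _≤?_; NonZero; _<?_; >-nonZero)
open import Data.Nat.Properties
open import Data.List using (List; []; _∷_; _∷ʳ_; length; applyUpTo)
open import Data.List.Properties using (length-++; length-applyUpTo)
open import Data.List.Relation.Unary.Linked using (Linked; [-]; _∷_)
open import Data.List.Relation.Unary.All using (All; []; _∷_; tabulate)
import Data.List.Relation.Unary.All as All
open import Data.List.Relation.Unary.Any using (here; there)
open import Data.List.Relation.Unary.AllPairs using ([]; _∷_)
open import Data.List.Relation.Unary.Unique.Propositional using (Unique)
open import Data.List.Membership.Propositional using (_∈_; _∉_)
open import Data.Product using (Σ; ∃; _×_; _,_; proj₁; proj₂)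
open import Data.Sum using (_⊎_; inj₁; inj₂; map₂)
open import Data.Empty using (⊥-elim; ⊥)
open import Relation.Nullary using (¬_; Dec; yes; no; contradiction)
open import Relation.Unary using (Decidable; ∁)
open import Relation.Binary using (DecidableEquality; tri<; tri≈; tri>)
open import Relation.Binary.PropositionalEquality
open import Algebra.Properties.CommutativeSemigroup +-commutativeSemigroup using () renaming (interchange to +-interchange)
open import Data.Nat.DivMod using (_%_; m%n<n; %-distribˡ-+; m<n⇒m%n≡m; [m+n]%n≡m%n; m%n%n≡m%n; [m+kn]%n≡m%n; n%n≡0; _/_; m≡m%n+[m/n]*n)
open import Relation.Unary.Properties using (∁?)
open import Relation.Nullary.Decidable using (decidable-stable)
open import Data.Fin using (Fin; toℕ; fromℕ; fromℕ<) renaming (zero to fzero)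
open import Data.Bool using (T; Bool; true; false; not)
open import Data.Nat.Divisibility using (_∣_; n∣m*n; ∣m∣n⇒∣m+n; ∣m+n∣m⇒∣n; ∣-refl; ∣1⇒≡1; ∣⇒≤; divides)
open import Data.Nat.Solver using (module +-*-Solver)
open import Data.Fin.Properties using (toℕ-injective; toℕ-fromℕ; toℕ<n; toℕ-fromℕ<)
import Data.Fin.Properties as Fin
import Data.Bool.Properties as Bool
import Data.Product.Properties as Product
import Data.Sum.Properties as Sum
open import Data.Sum.Properties using (inj₁-injective)
open import Function using (id)

module _ {A : Set} where

  length-∷ʳ : ∀ (xs : List A) z → length (xs ∷ʳ z) ≡ suc (length xs)
  length-∷ʳ xs z = trans (length-++ xs) (+-comm (length xs) 1)

  lookupOr : A → List A → ℕ → A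
  lookupOr d [] _ = d
  lookupOr d (x ∷ xs) zero = x
  lookupOr d (x ∷ xs) (suc i) = lookupOr d xs i

  Linked-lookupOr : ∀ {R : A → A → Set} d xs i → Linked R xs → suc i < length xs →
                    R (lookupOr d xs i) (lookupOr d xs (suc i))
  Linked-lookupOr d (x ∷ y ∷ ys) zero (r ∷ _) _ = r
  Linked-lookupOr d (x ∷ y ∷ ys) (suc i) (_ ∷ l) (s≤s p) = Linked-lookupOr d (y ∷ ys) i l p
  Linked-lookupOr d (x ∷ []) i _ (s≤s ())

  lookupOr∈ : ∀ d xs i → i < length xs → lookupOr d xs i ∈ xs
  lookupOr∈ d (x ∷ xs) zero _ = here refl
  lookupOr∈ d (x ∷ xs) (suc i) (s≤s p) = there (lookupOr∈ d xs i p)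

  ∈⇒lookupOr : ∀ d {a} xs → a ∈ xs → ∃ λ i → i < length xs × lookupOr d xs i ≡ a
  ∈⇒lookupOr d (x ∷ xs) (here p) = 0 , s≤s z≤n , sym p
  ∈⇒lookupOr d (x ∷ xs) (there p) with ∈⇒lookupOr d xs p
  ... | i , q , e = suc i , s≤s q , e

  Unique⇒lookupOr-injective : ∀ d xs i j → Unique xs → i < length xs → j < length xs →
                              lookupOr d xs i ≡ lookupOr d xs j → i ≡ j
  Unique⇒lookupOr-injective d (x ∷ xs) zero zero _ _ _ _ = refl
  Unique⇒lookupOr-injective d (x ∷ xs) zero (suc j) (x∉ ∷ _) _ (s≤s q) e =
    ⊥-elim (All.lookup x∉ (lookupOr∈ d xs j q) e)
  Unique⇒lookupOr-injective d (x ∷ xs) (suc i) zero (x∉ ∷ _) (s≤s p) _ e =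
    ⊥-elim (All.lookup x∉ (lookupOr∈ d xs i p) (sym e))
  Unique⇒lookupOr-injective d (x ∷ xs) (suc i) (suc j) (_ ∷ u) (s≤s p) (s≤s q) e =
    cong suc (Unique⇒lookupOr-injective d xs i j u p q e)

  lookupOr-last : ∀ d xs z → lookupOr d (xs ∷ʳ z) (length xs) ≡ z
  lookupOr-last d [] z = refl
  lookupOr-last d (x ∷ xs) z = lookupOr-last d xs z

  Linked-applyUpTo : (R : A → A → Set) (f : ℕ → A) (t : ℕ) → (∀ i → i ≤ t → R (f i) (f (suc i))) →
                     Linked R (f 0 ∷ (applyUpTo (λ i → f (suc i)) t ∷ʳ f (suc t)))
  Linked-applyUpTo R f zero h = h 0 z≤n ∷ [-]
  Linked-applyUpTo R f (suc t) h = h 0 z≤n ∷ Linked-applyUpTo R (λ i → f (suc i)) t (λ i le → h (suc i) (s≤s le))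

  All-applyUpTo : (P : A → Set) (f : ℕ → A) (t : ℕ) → (∀ i → i ≤ t → P (f (suc i))) →
                  All P (applyUpTo (λ i → f (suc i)) t ∷ʳ f (suc t))
  All-applyUpTo P f zero h = h 0 z≤n ∷ []
  All-applyUpTo P f (suc t) h = h 0 z≤n ∷ All-applyUpTo P (λ i → f (suc i)) t (λ i le → h (suc i) (s≤s le))

  Unique-applyUpTo : (f : ℕ → A) (t : ℕ) → (∀ i j → i ≤ suc t → j ≤ suc t → f i ≡ f j → i ≡ j) →
                     Unique (f 0 ∷ (applyUpTo (λ i → f (suc i)) t ∷ʳ f (suc t)))
  Unique-applyUpTo f zero inj = ((λ e → 0≢1+n (inj 0 1 z≤n ≤-refl e)) ∷ []) ∷ ([] ∷ [])
  Unique-applyUpTo f (suc t) inj =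
    All-applyUpTo (f 0 ≢_) f (suc t) (λ i le e → 0≢1+n (inj 0 (suc i) z≤n (s≤s le) e))
    ∷ Unique-applyUpTo (λ i → f (suc i)) t (λ i j le le′ e → suc-injective (inj (suc i) (suc j) (s≤s le) (s≤s le′) e))

≤-split : ∀ {a b} → a ≤ b → a ≡ b ⊎ b ≡ suc a ⊎ ∃ λ d → b ≡ suc (a + suc d)
≤-split {zero} {zero} _ = inj₁ refl
≤-split {zero} {suc zero} _ = inj₂ (inj₁ refl)
≤-split {zero} {suc (suc b)} _ = inj₂ (inj₂ (b , refl))
≤-split {suc a} {suc b} (s≤s a≤b) with ≤-split a≤b
... | inj₁ a≡b = inj₁ (cong suc a≡b)
... | inj₂ (inj₁ b≡1+a) = inj₂ (inj₁ (cong suc b≡1+a))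
... | inj₂ (inj₂ (d , b≡)) = inj₂ (inj₂ (d , cong suc b≡))

sumBelow : (ℕ → ℕ) → ℕ → ℕ
sumBelow f zero = 0
sumBelow f (suc l) = f 0 + sumBelow (λ i → f (suc i)) l

sumBelow-cong : ∀ l {f h : ℕ → ℕ} → (∀ i → i < l → f i ≡ h i) → sumBelow f l ≡ sumBelow h l
sumBelow-cong zero e = refl
sumBelow-cong (suc l) e = cong₂ _+_ (e 0 (s≤s z≤n)) (sumBelow-cong l (λ i p → e (suc i) (s≤s p)))

sumBelow-+ : ∀ a b (f : ℕ → ℕ) → sumBelow f (a + b) ≡ sumBelow f a + sumBelow (λ i → f (a + i)) b
sumBelow-+ zero b f = refl
sumBelow-+ (suc a) b f = trans (cong (f 0 +_) (sumBelow-+ a b (λ i → f (suc i)))) (sym (+-assoc (f 0) _ _))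

sumBelow-const : ∀ l k → sumBelow (λ _ → k) l ≡ l * k
sumBelow-const zero k = refl
sumBelow-const (suc l) k = cong (k +_) (sumBelow-const l k)

sumBelow-zero : ∀ l (f : ℕ → ℕ) → (∀ i → i < l → f i ≡ 0) → sumBelow f l ≡ 0
sumBelow-zero l f h = trans (sumBelow-cong l h) (trans (sumBelow-const l 0) (*-zeroʳ l))

sumBelow-distrib-+ : ∀ l (f h : ℕ → ℕ) → sumBelow (λ i → f i + h i) l ≡ sumBelow f l + sumBelow h l
sumBelow-distrib-+ zero f h = refl
sumBelow-distrib-+ (suc l) f h =
  trans (cong (f 0 + h 0 +_) (sumBelow-distrib-+ l (λ i → f (suc i)) (λ i → h (suc i))))
        (+-interchange (f 0) (h 0) _ _)

sumBelow-snoc : ∀ l (f : ℕ → ℕ) → sumBelow f (suc l) ≡ sumBelow f l + f l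
sumBelow-snoc zero f = +-identityʳ (f 0)
sumBelow-snoc (suc l) f =
  trans (cong (f 0 +_) (sumBelow-snoc l (λ i → f (suc i)))) (sym (+-assoc (f 0) _ (f (suc l))))

sumBelow-rotate : ∀ m (f : ℕ → ℕ) → (∀ i → f (i + m) ≡ f i) → ∀ s → sumBelow (λ i → f (s + i)) m ≡ sumBelow f m
sumBelow-rotate m f periodic zero = refl
sumBelow-rotate m f periodic (suc s) = begin
  sumBelow (λ i → f (suc s + i)) m   ≡⟨ sumBelow-cong m (λ i _ → cong f (sym (+-suc s i))) ⟩
  sumBelow (λ i → h (suc i)) m       ≡⟨ +-cancelʳ-≡ _ _ _ step ⟩
  sumBelow h m                       ≡⟨ sumBelow-rotate m f periodic s ⟩
  sumBelow f m                       ∎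
  where
  open ≡-Reasoning
  h : ℕ → ℕ
  h i = f (s + i)
  step : sumBelow (λ i → h (suc i)) m + h 0 ≡ sumBelow h m + h 0
  step = begin
    sumBelow (λ i → h (suc i)) m + h 0 ≡⟨ +-comm _ (h 0) ⟩
    sumBelow h (suc m)                 ≡⟨ sumBelow-snoc m h ⟩
    sumBelow h m + h m                 ≡⟨ cong (sumBelow h m +_) (trans (periodic s) (cong f (sym (+-identityʳ s)))) ⟩
    sumBelow h m + h 0                 ∎

sumBelow-positive : ∀ (f : ℕ → ℕ) l → 1 ≤ sumBelow f l → ∃ λ i → i < l × 1 ≤ f i
sumBelow-positive f zero ()
sumBelow-positive f (suc l) p with f 0 in e
... | suc _ = 0 , s≤s z≤n , subst (1 ≤_) (sym e) (s≤s z≤n)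
... | zero with sumBelow-positive (λ i → f (suc i)) l p
...   | i , i<l , q = suc i , s≤s i<l , q

indicator : {P : Set} → Dec P → ℕ
indicator (yes _) = 1
indicator (no _) = 0

indicator-yes : {P : Set} → P → (d : Dec P) → indicator d ≡ 1
indicator-yes p (yes _) = refl
indicator-yes p (no ¬p) = ⊥-elim (¬p p)

indicator-no : {P : Set} → ¬ P → (d : Dec P) → indicator d ≡ 0
indicator-no ¬p (yes p) = ⊥-elim (¬p p)
indicator-no ¬p (no _) = refl

sumBelow-indicator-≡ : ∀ k l → k < l → sumBelow (λ c → indicator (k ≟ c)) l ≡ 1
sumBelow-indicator-≡ zero (suc l) _ =
  cong suc (sumBelow-zero l _ (λ i _ → indicator-no (λ ()) (0 ≟ suc i)))
sumBelow-indicator-≡ (suc k) (suc l) (s≤s k<l) =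
  trans (sumBelow-cong l (λ i _ → shift i)) (sumBelow-indicator-≡ k l k<l)
  where
  shift : ∀ i → indicator (suc k ≟ suc i) ≡ indicator (k ≟ i)
  shift i with k ≟ i
  ... | yes refl = indicator-yes refl (suc k ≟ suc k)
  ... | no k≢i = indicator-no (λ e → k≢i (suc-injective e)) (suc k ≟ suc i)

module _ {A : Set} {P : A → Set} (P? : Decidable P) where

  count : List A → ℕ
  count [] = 0
  count (x ∷ xs) = indicator (P? x) + count xs

  count-sumBelow : ∀ d xs → count xs ≡ sumBelow (λ i → indicator (P? (lookupOr d xs i))) (length xs)
  count-sumBelow d [] = refl
  count-sumBelow d (x ∷ xs) = cong (indicator (P? x) +_) (count-sumBelow d xs)

  count>0⇒∃ : ∀ xs → 1 ≤ count xs → ∃ λ a → a ∈ xs × P a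
  count>0⇒∃ (x ∷ xs) p with P? x
  ... | yes px = x , here refl , px
  ... | no _ with count>0⇒∃ xs p
  ...   | a , a∈xs , pa = a , there a∈xs , pa

  count≡0⇒¬ : ∀ xs → count xs ≡ 0 → ∀ {a} → a ∈ xs → ¬ P a
  count≡0⇒¬ (x ∷ xs) e (here refl) pa with P? x
  ... | yes _ = 1+n≢0 e
  ... | no ¬px = ¬px pa
  count≡0⇒¬ (x ∷ xs) e (there a∈xs) pa with P? x
  ... | yes _ = 1+n≢0 e
  ... | no _ = count≡0⇒¬ xs e a∈xs pa

module _ {A : Set} (_≟A_ : DecidableEquality A) where

  occurrences : A → List A → ℕ
  occurrences a = count (_≟A a)

  Unique⇒occurrences≤1 : ∀ a xs → Unique xs → occurrences a xs ≤ 1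
  Unique⇒occurrences≤1 a [] _ = z≤n
  Unique⇒occurrences≤1 a (x ∷ xs) (x∉ ∷ u) with x ≟A a
  ... | no _ = Unique⇒occurrences≤1 a xs u
  ... | yes refl = s≤s (≤-reflexive (none xs x∉))
    where
    none : ∀ ys → All (x ≢_) ys → occurrences x ys ≡ 0
    none [] _ = refl
    none (y ∷ ys) (x≢y ∷ x∉ys) with y ≟A x
    ... | yes y≡x = ⊥-elim (x≢y (sym y≡x))
    ... | no _ = none ys x∉ys

  ∈⇒occurrences>0 : ∀ a xs → a ∈ xs → 1 ≤ occurrences a xs
  ∈⇒occurrences>0 a (x ∷ xs) a∈ with x ≟A a
  ... | yes _ = s≤s z≤n
  ∈⇒occurrences>0 a (x ∷ xs) (here a≡x) | no x≢a = ⊥-elim (x≢a (sym a≡x))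
  ∈⇒occurrences>0 a (x ∷ xs) (there a∈xs) | no _ = ∈⇒occurrences>0 a xs a∈xs

  occurrences>0⇒∈ : ∀ a xs → 1 ≤ occurrences a xs → a ∈ xs
  occurrences>0⇒∈ a (x ∷ xs) p with x ≟A a
  ... | yes x≡a = here (sym x≡a)
  ... | no _ = there (occurrences>0⇒∈ a xs p)

minimal : ∀ {P : ℕ → Set} → Decidable P → ∀ T → P T →
          ∃ λ t → t ≤ T × P t × (∀ t′ → t′ < t → ¬ P t′)
minimal P? zero p0 = 0 , z≤n , p0 , λ _ ()
minimal P? (suc T) pT with P? 0
... | yes p0 = 0 , z≤n , p0 , λ _ ()
... | no ¬p0 with minimal (λ i → P? (suc i)) T pT
...   | t , t≤T , pt , below = suc t , s≤s t≤T , pt , λ { zero _ → ¬p0 ; (suc t′) (s≤s lt) → below t′ lt }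

maximal : ∀ {P : ℕ → Set} → Decidable P → ∀ B c → c ≤ B → P c →
          ∃ λ t → c ≤ t × t ≤ B × P t × (∀ t′ → t < t′ → t′ ≤ B → ¬ P t′)
maximal {P} P? B c c≤B pc with P? B
... | yes pB = B , c≤B , ≤-refl , pB , λ _ lt le → ⊥-elim (<⇒≱ lt le)
... | no ¬pB with m≤n⇒m<n∨m≡n c≤B
...   | inj₂ refl = ⊥-elim (¬pB pc)
maximal {P} P? (suc B) c _ pc | no ¬pB | inj₁ (s≤s c≤B) with maximal P? B c c≤B pc
... | t , c≤t , t≤B , pt , above = t , c≤t , m≤n⇒m≤1+n t≤B , pt , above′
  where
  above′ : ∀ t′ → t < t′ → t′ ≤ suc B → ¬ P t′
  above′ t′ lt le with m≤n⇒m<n∨m≡n le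
  ... | inj₁ (s≤s le′) = above t′ lt le′
  ... | inj₂ refl = ¬pB

[3k+r]%3≡r : ∀ k r → r < 3 → (3 * k + r) % 3 ≡ r
[3k+r]%3≡r k r r<3 = begin
  (3 * k + r) % 3    ≡⟨ cong (_% 3) (trans (+-comm (3 * k) r) (cong (r +_) (*-comm 3 k))) ⟩
  (r + k * 3) % 3    ≡⟨ [m+kn]%n≡m%n r k 3 ⟩
  r % 3              ≡⟨ m<n⇒m%n≡m r<3 ⟩
  r                  ∎
  where open ≡-Reasoning

3k%3≡0 : ∀ k → (3 * k) % 3 ≡ 0
3k%3≡0 k = trans (cong (_% 3) (sym (+-identityʳ (3 * k)))) ([3k+r]%3≡r k 0 (s≤s z≤n))

%3-cases : ∀ c → c % 3 ≡ 0 ⊎ c % 3 ≡ 1 ⊎ c % 3 ≡ 2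
%3-cases c with c % 3 | m%n<n c 3
... | 0 | _ = inj₁ refl
... | 1 | _ = inj₂ (inj₁ refl)
... | 2 | _ = inj₂ (inj₂ refl)
... | suc (suc (suc _)) | s≤s (s≤s (s≤s ()))

%3-suc : ∀ c r → c % 3 ≡ r → suc c % 3 ≡ suc r % 3
%3-suc c r c%3≡r = begin
  suc c % 3                ≡⟨ %-distribˡ-+ 1 c 3 ⟩
  (1 + c % 3) % 3          ≡⟨ cong (λ z → (1 + z) % 3) (sym (m%n%n≡m%n c 3)) ⟩
  (1 + c % 3 % 3) % 3      ≡⟨ sym (%-distribˡ-+ 1 (c % 3) 3) ⟩
  suc (c % 3) % 3          ≡⟨ cong (λ z → suc z % 3) c%3≡r ⟩
  suc r % 3                ∎
  where open ≡-Reasoning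

%3≡1⇒suc : ∀ c → c % 3 ≡ 1 → ∃ λ c′ → c ≡ suc c′
%3≡1⇒suc (suc c) _ = c , refl

∣-by-residue : ∀ a k m r → m % 3 ≡ r → 3 ∣ a + k * r → 3 ∣ a + k * m
∣-by-residue a k m r m%3≡r 3∣a+kr = subst (3 ∣_) (sym a+km≡) (∣m∣n⇒∣m+n 3∣a+kr (n∣m*n (k * (m / 3))))
  where
  open +-*-Solver
  a+km≡ : a + k * m ≡ a + k * r + k * (m / 3) * 3
  a+km≡ = trans (cong (λ z → a + k * z) (trans (m≡m%n+[m/n]*n m 3) (cong (_+ m / 3 * 3) m%3≡r)))
                (solve 4 (λ a k r q → a :+ k :* (r :+ q :* con 3) := a :+ k :* r :+ k :* q :* con 3) refl a k r (m / 3))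

ladder-sum-∣ : ∀ e₀ e₁ m d → 3 ∣ e₀ + 1 + m → 3 ∣ e₁ + 1 + 2 * suc (m + d) → 3 ∣ suc (e₀ + 2 * d + e₁)
ladder-sum-∣ e₀ e₁ m d left right = ∣m+n∣m⇒∣n (subst (3 ∣_) regroup (∣m∣n⇒∣m+n left right)) (n∣m*n (suc m))
  where
  open +-*-Solver
  regroup : e₀ + 1 + m + (e₁ + 1 + 2 * suc (m + d)) ≡ suc m * 3 + suc (e₀ + 2 * d + e₁)
  regroup = solve 4 (λ e₀ e₁ m d → e₀ :+ con 1 :+ m :+ (e₁ :+ con 1 :+ con 2 :* (con 1 :+ (m :+ d)))
                                  := (con 1 :+ m) :* con 3 :+ (con 1 :+ (e₀ :+ con 2 :* d :+ e₁))) refl e₀ e₁ m d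

3∤1 : ¬ 3 ∣ 1
3∤1 3∣1 with ∣1⇒≡1 3∣1
... | ()

3∤4 : ¬ 3 ∣ 4
3∤4 3∣4 = 3∤1 (∣m+n∣m⇒∣n 3∣4 ∣-refl)

3∤1≤n≤2 : ∀ n → 1 ≤ n → n ≤ 2 → ¬ 3 ∣ n
3∤1≤n≤2 n 1≤n n≤2 3∣n = <⇒≱ (s≤s n≤2) (∣⇒≤ {{>-nonZero 1≤n}} 3∣n)

3∣n⇒3∤1+n : ∀ n → 3 ∣ n → ¬ 3 ∣ suc n
3∣n⇒3∤1+n n 3∣n 3∣1+n = 3∤1 (∣m+n∣m⇒∣n (subst (3 ∣_) (+-comm 1 n) 3∣1+n) 3∣n)

3∣1+l+n⇒3∣l : ∀ l n → 3 ∣ suc l + n → 3 ∣ suc n → 3 ∣ l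
3∣1+l+n⇒3∣l l n 3∣1+l+n 3∣1+n = ∣m+n∣m⇒∣n (subst (3 ∣_) (cong suc (+-comm l n)) 3∣1+l+n) 3∣1+n

%-absorbʳ-+ : ∀ k j n .{{_ : NonZero n}} → (k + j) % n ≡ (k + j % n) % n
%-absorbʳ-+ k j n = begin
  (k + j) % n                ≡⟨ %-distribˡ-+ k j n ⟩
  (k % n + j % n) % n        ≡⟨ cong (λ z → (k % n + z) % n) (sym (m%n%n≡m%n j n)) ⟩
  (k % n + j % n % n) % n    ≡⟨ sym (%-distribˡ-+ k (j % n) n) ⟩
  (k + j % n) % n            ∎
  where open ≡-Reasoning

+-%-≢ : ∀ a d n .{{_ : NonZero n}} → 0 < d → d < n → (d + a) % n ≢ a % n
+-%-≢ a d n 0<d d<n e with d + a % n <? n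
... | yes lt = <⇒≢ (+-monoˡ-< (a % n) 0<d)
                 (sym (trans (sym (m<n⇒m%n≡m lt)) (trans (sym (%-absorbʳ-+ d a n)) e)))
... | no ¬lt = <⇒≢ d<n (sym (+-cancelˡ-≡ r n d (begin
  r + n            ≡⟨ cong (_+ n) (sym wrapped≡r) ⟩
  wrapped + n      ≡⟨ m∸n+n≡m n≤d+r ⟩
  d + r            ≡⟨ +-comm d r ⟩
  r + d            ∎)))
  where
  open ≡-Reasoning
  r : ℕ
  r = a % n
  n≤d+r : n ≤ d + r
  n≤d+r = ≮⇒≥ ¬lt
  wrapped : ℕ
  wrapped = d + r ∸ n
  wrapped<n : wrapped < n
  wrapped<n = +-cancelʳ-< n wrapped n
    (subst (_< n + n) (sym (m∸n+n≡m n≤d+r)) (+-mono-<-≤ d<n (<⇒≤ (m%n<n a n))))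
  wrapped≡r : wrapped ≡ r
  wrapped≡r = begin
    wrapped                ≡⟨ sym (m<n⇒m%n≡m wrapped<n) ⟩
    wrapped % n            ≡⟨ sym ([m+n]%n≡m%n wrapped n) ⟩
    (wrapped + n) % n      ≡⟨ cong (_% n) (m∸n+n≡m n≤d+r) ⟩
    (d + r) % n            ≡⟨ sym (%-absorbʳ-+ d a n) ⟩
    (d + a) % n            ≡⟨ e ⟩
    r                      ∎

+-%-≢-< : ∀ s i i′ n .{{_ : NonZero n}} → i < i′ → i′ < n → (s + i′) % n ≢ (s + i) % n
+-%-≢-< s i i′ n i<i′ i′<n = subst (λ z → z % n ≢ (s + i) % n) shift
  (+-%-≢ (s + i) (i′ ∸ i) n (m<n⇒0<n∸m i<i′) (≤-<-trans (m∸n≤m i′ i) i′<n))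
  where
  shift : i′ ∸ i + (s + i) ≡ s + i′
  shift = trans (+-comm (i′ ∸ i) (s + i)) (trans (+-assoc s i (i′ ∸ i)) (cong (s +_) (m+[n∸m]≡n (<⇒≤ i<i′))))

+-%-injective : ∀ s i i′ n .{{_ : NonZero n}} → i < n → i′ < n → (s + i) % n ≡ (s + i′) % n → i ≡ i′
+-%-injective s i i′ n i<n i′<n e with <-cmp i i′
... | tri< i<i′ _ _ = ⊥-elim (+-%-≢-< s i i′ n i<i′ i′<n (sym e))
... | tri≈ _ i≡i′ _ = i≡i′
... | tri> _ _ i′<i = ⊥-elim (+-%-≢-< s i′ i n i′<i i<n e)

module CycleWalk {V : Set} (R : V → V → Set) (C : Cycle R) where
  open Cycle C

  verts : List V
  verts = cycleVertices R C

  len : ℕ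
  len = cycleLength R C

  length-verts : length verts ≡ len
  length-verts = cong suc (length-∷ʳ mid lastv)

  3≤len : 3 ≤ len
  3≤len = s≤s (s≤s midNE)

  at : ℕ → V
  at j = lookupOr first verts (j % len)

  at-periodic : ∀ j → at (j + len) ≡ at j
  at-periodic j = cong (lookupOr first verts) ([m+n]%n≡m%n j len)

  at-multiple : ∀ j k → at (j + k * len) ≡ at j
  at-multiple j k = cong (lookupOr first verts) ([m+kn]%n≡m%n j k len)

  at-+% : ∀ k j → at (k + j) ≡ at (k + j % len)
  at-+% k j = cong (lookupOr first verts) (%-absorbʳ-+ k j len)

  at-< : ∀ i → i < len → at i ≡ lookupOr first verts i
  at-< i i<len = cong (lookupOr first verts) (m<n⇒m%n≡m i<len)

  private
    %len<length : ∀ j → j % len < length verts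
    %len<length j = subst (j % len <_) (sym length-verts) (m%n<n j len)

  at-adj : ∀ j → R (at j) (at (suc j))
  at-adj j with suc (j % len) <? len | m%n<n j len
  ... | yes lt | _ = subst (R (at j)) (sym (trans (at-+% 1 j) (at-< _ lt)))
                       (Linked-lookupOr first verts (j % len) linked (subst (suc (j % len) <_) (sym length-verts) lt))
  ... | no ¬lt | j%len<len = subst₂ R (sym at-j≡lastv) (sym at-1+j≡first) closing
    where
    wraps : suc (j % len) ≡ len
    wraps = ≤-antisym j%len<len (≮⇒≥ ¬lt)
    at-j≡lastv : at j ≡ lastv
    at-j≡lastv = trans (cong (lookupOr first verts) (suc-injective wraps)) (lookupOr-last first mid lastv)
    at-1+j≡first : at (suc j) ≡ first
    at-1+j≡first = trans (at-+% 1 j) (trans (cong at wraps) (cong (lookupOr first verts) (n%n≡0 len)))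

  at-injective : ∀ i j → at i ≡ at j → i % len ≡ j % len
  at-injective i j = Unique⇒lookupOr-injective first verts (i % len) (j % len) unique (%len<length i) (%len<length j)

  at-injective-window : ∀ s i i′ → i < len → i′ < len → at (s + i) ≡ at (s + i′) → i ≡ i′
  at-injective-window s i i′ i<len i′<len e = +-%-injective s i i′ len i<len i′<len (at-injective (s + i) (s + i′) e)

  at∈ : ∀ j → at j ∈ verts
  at∈ j = lookupOr∈ first verts (j % len) (%len<length j)

  ∈⇒at : ∀ {w} → w ∈ verts → ∃ λ i → at i ≡ w
  ∈⇒at w∈ with ∈⇒lookupOr first verts w∈
  ... | i , i<length , e = i , trans (at-< i (subst (i <_) length-verts i<length)) e

  at-suc-cong : ∀ i j → at i ≡ at j → at (suc i) ≡ at (suc j)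
  at-suc-cong i j e = begin
    at (suc i)           ≡⟨ at-+% 1 i ⟩
    at (suc (i % len))   ≡⟨ cong (λ z → at (suc z)) (at-injective i j e) ⟩
    at (suc (j % len))   ≡⟨ sym (at-+% 1 j) ⟩
    at (suc j)           ∎
    where open ≡-Reasoning

  at-pred-cong : ∀ i j → at (suc i) ≡ at (suc j) → at i ≡ at j
  at-pred-cong i j e = begin
    at i                          ≡⟨ sym (at-periodic i) ⟩
    at (i + len)                  ≡⟨ cong at (sym (wrap i)) ⟩
    at (len ∸ 1 + suc i)          ≡⟨ at-+% (len ∸ 1) (suc i) ⟩
    at (len ∸ 1 + suc i % len)    ≡⟨ cong (λ z → at (len ∸ 1 + z)) (at-injective (suc i) (suc j) e) ⟩
    at (len ∸ 1 + suc j % len)    ≡⟨ sym (at-+% (len ∸ 1) (suc j)) ⟩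
    at (len ∸ 1 + suc j)          ≡⟨ cong at (wrap j) ⟩
    at (j + len)                  ≡⟨ at-periodic j ⟩
    at j                          ∎
    where
    open ≡-Reasoning
    wrap : ∀ k → len ∸ 1 + suc k ≡ k + len
    wrap k = trans (+-suc (len ∸ 1) k) (+-comm len k)

  at-2+≢ : ∀ i → at (2 + i) ≢ at i
  at-2+≢ i e = +-%-≢ i 2 len (s≤s z≤n) 3≤len (at-injective (2 + i) i e)

  leaves : (P : V → Set) → Decidable P → ∀ a b → P (at a) → ¬ P (at b) → ∃ λ j → P (at j) × ¬ P (at (suc j))
  leaves P P? a b pa ¬pb =
    walk (b + a * len ∸ a) (subst (λ z → ¬ P (at z)) (sym a+k≡) (subst (λ w → ¬ P w) (sym (at-multiple b a)) ¬pb))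
    where
    a+k≡ : a + (b + a * len ∸ a) ≡ b + a * len
    a+k≡ = m+[n∸m]≡n (≤-trans (m≤m*n a len) (m≤n+m (a * len) b))
    walk : ∀ k → ¬ P (at (a + k)) → ∃ λ j → P (at j) × ¬ P (at (suc j))
    walk zero ¬p = ⊥-elim (¬p (subst (λ z → P (at z)) (sym (+-identityʳ a)) pa))
    walk (suc k) ¬p with P? (at (a + k))
    ... | yes p = a + k , p , subst (λ z → ¬ P (at z)) (+-suc a k) ¬p
    ... | no ¬p′ = walk k ¬p′

  Step : V → V → Set
  Step a b = ∃ λ j → at j ≡ a × at (suc j) ≡ b

  Nbr : V → V → Set
  Nbr w a = Step w a ⊎ Step a w

  Nbr-sym : ∀ {w a} → Nbr w a → Nbr a w
  Nbr-sym (inj₁ s) = inj₂ s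
  Nbr-sym (inj₂ s) = inj₁ s

  Nbr⇒R : ∀ {w a} → Nbr w a → R w a ⊎ R a w
  Nbr⇒R (inj₁ (j , refl , refl)) = inj₁ (at-adj j)
  Nbr⇒R (inj₂ (j , refl , refl)) = inj₂ (at-adj j)

  Nbr⇒∈ : ∀ {w a} → Nbr w a → a ∈ verts
  Nbr⇒∈ (inj₁ (j , _ , refl)) = at∈ (suc j)
  Nbr⇒∈ (inj₂ (j , refl , _)) = at∈ j

  two-Nbrs : ∀ {w} → w ∈ verts → ∃ λ a → ∃ λ b → a ≢ b × Nbr w a × Nbr w b
  two-Nbrs w∈ with ∈⇒at w∈
  ... | i , refl = at (suc i) , at (len ∸ 1 + i) , distinct ,
                   inj₁ (i , refl , refl) , inj₂ (len ∸ 1 + i , refl , at-periodic′)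
    where
    at-periodic′ : at (suc (len ∸ 1 + i)) ≡ at i
    at-periodic′ = trans (cong at (+-comm len i)) (at-periodic i)
    distinct : at (suc i) ≢ at (len ∸ 1 + i)
    distinct e = at-2+≢ i (trans (at-suc-cong (suc i) (len ∸ 1 + i) e) at-periodic′)

  Step-functional : ∀ {w a b} → Step w a → Step w b → a ≡ b
  Step-functional (j , refl , refl) (k , e , refl) = at-suc-cong j k (sym e)

  Step-injective : ∀ {w a b} → Step a w → Step b w → a ≡ b
  Step-injective (j , refl , refl) (k , refl , e) = at-pred-cong j k (sym e)

  ¬three-Nbrs : ∀ {w a b c} → Nbr w a → Nbr w b → Nbr w c → a ≢ b → b ≢ c → a ≢ c → ⊥
  ¬three-Nbrs (inj₁ wa) (inj₁ wb) _ a≢b _ _ = a≢b (Step-functional wa wb)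
  ¬three-Nbrs (inj₂ aw) (inj₂ bw) _ a≢b _ _ = a≢b (Step-injective aw bw)
  ¬three-Nbrs (inj₁ wa) (inj₂ _) (inj₁ wc) _ _ a≢c = a≢c (Step-functional wa wc)
  ¬three-Nbrs (inj₁ _) (inj₂ bw) (inj₂ cw) _ b≢c _ = b≢c (Step-injective bw cw)
  ¬three-Nbrs (inj₂ _) (inj₁ wb) (inj₁ wc) _ b≢c _ = b≢c (Step-functional wb wc)
  ¬three-Nbrs (inj₂ aw) (inj₁ _) (inj₂ cw) _ _ a≢c = a≢c (Step-injective aw cw)

  ¬Step-back : ∀ {p q} → Step p q → Step q p → ⊥
  ¬Step-back (j , refl , refl) (k , e₁ , e₂) = at-2+≢ k (trans (at-suc-cong (suc k) j e₂) (sym e₁))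

  Nbrs-among : ∀ {w} p q → w ∈ verts → (∀ z → Nbr w z → z ≡ p ⊎ z ≡ q) → Nbr w p × Nbr w q
  Nbrs-among p q w∈ among with two-Nbrs w∈
  ... | a , b , a≢b , wa , wb with among a wa | among b wb
  ... | inj₁ refl | inj₁ refl = ⊥-elim (a≢b refl)
  ... | inj₁ refl | inj₂ refl = wa , wb
  ... | inj₂ refl | inj₁ refl = wb , wa
  ... | inj₂ refl | inj₂ refl = ⊥-elim (a≢b refl)

  ¬unique-Nbr : ∀ {w} p → w ∈ verts → (∀ z → Nbr w z → z ≡ p) → ⊥
  ¬unique-Nbr p w∈ only with two-Nbrs w∈
  ... | a , b , a≢b , wa , wb = a≢b (trans (only a wa) (sym (only b wb)))

  -- A cycle meeting both P and its complement crosses the boundary of P twice, in opposite directions.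
  two-edge-cut : (∀ {a b} → R a b → R b a) → (P : V → Set) → Decidable P → (p₁ q₁ p₂ q₂ : V) →
                 (∀ w z → P w → ¬ P z → R w z → (w ≡ p₁ × z ≡ q₁) ⊎ (w ≡ p₂ × z ≡ q₂)) →
                 ∀ a b → P (at a) → ¬ P (at b) → Nbr p₁ q₁ × Nbr p₂ q₂
  two-edge-cut R-sym P P? p₁ q₁ p₂ q₂ cut a b pa ¬pb = combine leaving entering
    where
    leaving : Step p₁ q₁ ⊎ Step p₂ q₂
    leaving with leaves P P? a b pa ¬pb
    ... | j , pj , ¬pj′ with cut _ _ pj ¬pj′ (at-adj j)
    ...   | inj₁ (e₁ , e₂) = inj₁ (j , e₁ , e₂)
    ...   | inj₂ (e₁ , e₂) = inj₂ (j , e₁ , e₂)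
    entering : Step q₁ p₁ ⊎ Step q₂ p₂
    entering with leaves (∁ P) (∁? P?) b a ¬pb (λ ¬p → ¬p pa)
    ... | k , ¬pk , ¬¬pk′ with cut _ _ (decidable-stable (P? (at (suc k))) ¬¬pk′) ¬pk (R-sym (at-adj k))
    ...   | inj₁ (e₁ , e₂) = inj₁ (k , e₂ , e₁)
    ...   | inj₂ (e₁ , e₂) = inj₂ (k , e₂ , e₁)
    combine : Step p₁ q₁ ⊎ Step p₂ q₂ → Step q₁ p₁ ⊎ Step q₂ p₂ → Nbr p₁ q₁ × Nbr p₂ q₂
    combine (inj₁ s) (inj₁ t) = ⊥-elim (¬Step-back s t)
    combine (inj₁ s) (inj₂ t) = inj₁ s , inj₂ t
    combine (inj₂ s) (inj₁ t) = inj₂ t , inj₁ s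
    combine (inj₂ s) (inj₂ t) = ⊥-elim (¬Step-back s t)

path-from-walk : ∀ {A : Set} (R : A → A → Set) (f : ℕ → A) (t : ℕ) →
                 (∀ i → i ≤ t → R (f i) (f (suc i))) →
                 (∀ i j → i ≤ suc t → j ≤ suc t → f i ≡ f j → i ≡ j) →
                 Σ (Path R (f 0) (f (suc t))) λ p → pathLength R p ≡ suc t
path-from-walk R f t adj inj =
  mkPath (applyUpTo (λ i → f (suc i)) t) (Linked-applyUpTo R f t adj) (Unique-applyUpTo f t inj) ,
  cong suc (length-applyUpTo (λ i → f (suc i)) t)

Adj-sym : ∀ {n} (G : Graph n) {a b} → Adj G a b → Adj G b a
Adj-sym G {a} {b} = subst T (Graph.sym G a b)

-- The part of a cycle inside a copy e of G, attached to the rest of the graph only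
-- through edges at e x and e y, is (the image of) an x–y path of G.
module Trace {V : Set} (_~_ : V → V → Set) (~-sym : ∀ {a b} → a ~ b → b ~ a) (C : Cycle _~_)
             {n : ℕ} (G : Graph n) (x y : Fin n) (x≢y : x ≢ y)
             (e : Fin n → V) (e-injective : ∀ {a b} → e a ≡ e b → a ≡ b)
             (~⇒Adj : ∀ {a b} → e a ~ e b → Adj G a b)
             (Q : V → Set) (Q? : Decidable Q) (Q⇒image : ∀ {w} → Q w → ∃ λ a → w ≡ e a) (Q-e : ∀ a → Q (e a))
             (px py : V) (cut : ∀ w z → Q w → ¬ Q z → w ~ z → (w ≡ e x × z ≡ px) ⊎ (w ≡ e y × z ≡ py))
             where
  open CycleWalk _~_ C

  Traced : Set
  Traced = Σ (Path (Adj G) x y) λ p → count Q? verts ≡ suc (pathLength (Adj G) p)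

  private
    preimage : V → Fin n
    preimage w with Q? w
    ... | yes q = proj₁ (Q⇒image q)
    ... | no _ = x

    preimage-e : ∀ {w} → Q w → w ≡ e (preimage w)
    preimage-e {w} q with Q? w
    ... | yes q′ = proj₂ (Q⇒image q′)
    ... | no ¬q = ⊥-elim (¬q q)

    preimage-inverse : ∀ a → preimage (e a) ≡ a
    preimage-inverse a = sym (e-injective (preimage-e (Q-e a)))

    ¬¬Q : ∀ {w} → ¬ ¬ Q w → Q w
    ¬¬Q {w} = decidable-stable (Q? w)

  -- The maximal run of Q-vertices at (j + 1), …, at (j + 1 + t) entered through the edge at j – at (j + 1).
  module Run (j : ℕ) (¬Qj : ¬ Q (at j)) (Q1+j : Q (at (suc j))) where
    s : ℕ
    s = suc j

    private
      Exits : ℕ → Set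
      Exits t = ¬ Q (at (s + suc t))

      Exits? : Decidable Exits
      Exits? t = ∁? Q? (at (s + suc t))

      exits-at-j : Exits (length (Cycle.mid C))
      exits-at-j = subst (λ w → ¬ Q w) (sym (trans (cong at (sym (+-suc j (suc (length (Cycle.mid C)))))) (at-periodic j))) ¬Qj

      first-exit : ∃ λ t → t ≤ length (Cycle.mid C) × Exits t × (∀ t′ → t′ < t → ¬ Exits t′)
      first-exit = minimal Exits? (length (Cycle.mid C)) exits-at-j

    t : ℕ
    t = proj₁ first-exit

    1+t<len : suc t < len
    1+t<len = s≤s (s≤s (proj₁ (proj₂ first-exit)))

    t<len : t < len
    t<len = <-trans (n<1+n t) 1+t<len

    exits : ¬ Q (at (s + suc t))
    exits = proj₁ (proj₂ (proj₂ first-exit))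

    run : ∀ i → i ≤ t → Q (at (s + i))
    run zero _ = subst Q (cong at (sym (+-identityʳ s))) Q1+j
    run (suc i) i<t = ¬¬Q (proj₂ (proj₂ (proj₂ first-exit)) i i<t)

    at-s+-adj : ∀ i → at (s + i) ~ at (s + suc i)
    at-s+-adj i = subst (at (s + i) ~_) (cong at (sym (+-suc s i))) (at-adj (s + i))

    at-s+0 : at (s + 0) ≡ at s
    at-s+0 = cong at (+-identityʳ s)

    enter : (at s ≡ e x × at j ≡ px) ⊎ (at s ≡ e y × at j ≡ py)
    enter = cut (at s) (at j) Q1+j ¬Qj (~-sym (at-adj j))

    leave : (at (s + t) ≡ e x × at (s + suc t) ≡ px) ⊎ (at (s + t) ≡ e y × at (s + suc t) ≡ py)
    leave = cut _ _ (run t ≤-refl) exits (at-s+-adj t)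

    f : ℕ → Fin n
    f i = preimage (at (s + i))

    at≡e-f : ∀ i → i ≤ t → at (s + i) ≡ e (f i)
    at≡e-f i i≤t = preimage-e (run i i≤t)

    f-adj : ∀ i → i < t → Adj G (f i) (f (suc i))
    f-adj i i<t = ~⇒Adj (subst₂ _~_ (at≡e-f i (<⇒≤ i<t)) (at≡e-f (suc i) i<t) (at-s+-adj i))

    f-injective : ∀ i i′ → i ≤ t → i′ ≤ t → f i ≡ f i′ → i ≡ i′
    f-injective i i′ i≤t i′≤t fi≡fi′ =
      at-injective-window s i i′ (≤-<-trans i≤t t<len) (≤-<-trans i′≤t t<len)
        (trans (at≡e-f i i≤t) (trans (cong e fi≡fi′) (sym (at≡e-f i′ i′≤t))))

    f0 : ∀ {a} → at s ≡ e a → f 0 ≡ a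
    f0 q = trans (cong preimage (trans at-s+0 q)) (preimage-inverse _)

    ft : ∀ {a} → at (s + t) ≡ e a → f t ≡ a
    ft q = trans (cong preimage q) (preimage-inverse _)

    run-is-all : (∀ w → w ≡ e x ⊎ w ≡ e y → w ≡ at s ⊎ w ≡ at (s + t)) →
                 ∀ k → suc t + k < len → ¬ Q (at (s + (suc t + k)))
    run-is-all ends zero _ = subst (λ w → ¬ Q w) (cong (λ z → at (s + z)) (sym (+-identityʳ (suc t)))) exits
    run-is-all ends (suc k) bound q =
      clash (ends _ (inner-end (cut _ _ q (run-is-all ends k (<-trans (+-monoʳ-< (suc t) (n<1+n k)) bound)) back)))
      where
      back : at (s + (suc t + suc k)) ~ at (s + (suc t + k))
      back = ~-sym (subst (at (s + (suc t + k)) ~_) (cong (λ z → at (s + z)) (sym (+-suc (suc t) k))) (at-s+-adj (suc t + k)))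
      inner-end : ∀ {w z} → (w ≡ e x × z ≡ px) ⊎ (w ≡ e y × z ≡ py) → w ≡ e x ⊎ w ≡ e y
      inner-end (inj₁ (w≡ex , _)) = inj₁ w≡ex
      inner-end (inj₂ (w≡ey , _)) = inj₂ w≡ey
      clash : at (s + (suc t + suc k)) ≡ at s ⊎ at (s + (suc t + suc k)) ≡ at (s + t) → ⊥
      clash (inj₁ q₁) = 1+n≢0 (at-injective-window s _ 0 bound (≤-<-trans z≤n t<len) (trans q₁ (sym at-s+0)))
      clash (inj₂ q₂) = <⇒≢ (≤-trans (n<1+n t) (m≤m+n (suc t) (suc k))) (sym (at-injective-window s _ t bound t<len q₂))

    count-run : (∀ w → w ≡ e x ⊎ w ≡ e y → w ≡ at s ⊎ w ≡ at (s + t)) → count Q? verts ≡ suc t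
    count-run ends = begin
      count Q? verts                                      ≡⟨ count-sumBelow Q? (Cycle.first C) verts ⟩
      sumBelow (λ i → χ (lookupOr (Cycle.first C) verts i)) (length verts)
                                                          ≡⟨ cong (sumBelow (λ i → χ (lookupOr (Cycle.first C) verts i))) length-verts ⟩
      sumBelow (λ i → χ (lookupOr (Cycle.first C) verts i)) len
                                                          ≡⟨ sumBelow-cong len (λ i i<len → cong χ (sym (at-< i i<len))) ⟩
      sumBelow (λ i → χ (at i)) len                       ≡⟨ sym (sumBelow-rotate len (λ i → χ (at i)) (λ i → cong χ (at-periodic i)) s) ⟩
      sumBelow (λ i → χ (at (s + i))) len                 ≡⟨ cong (sumBelow (λ i → χ (at (s + i)))) (sym (m+[n∸m]≡n (<⇒≤ 1+t<len))) ⟩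
      sumBelow (λ i → χ (at (s + i))) (suc t + (len ∸ suc t))
                                                          ≡⟨ sumBelow-+ (suc t) (len ∸ suc t) (λ i → χ (at (s + i))) ⟩
      sumBelow (λ i → χ (at (s + i))) (suc t) + sumBelow (λ i → χ (at (s + (suc t + i)))) (len ∸ suc t)
                                                          ≡⟨ cong₂ _+_ inside outside ⟩
      suc t + 0                                           ≡⟨ +-identityʳ (suc t) ⟩
      suc t                                               ∎
      where
      open ≡-Reasoning
      χ : V → ℕ
      χ w = indicator (Q? w)
      inside : sumBelow (λ i → χ (at (s + i))) (suc t) ≡ suc t
      inside = trans (sumBelow-cong (suc t) (λ i i<1+t → indicator-yes (run i (s≤s⁻¹ i<1+t)) (Q? _)))
                     (trans (sumBelow-const (suc t) 1) (*-identityʳ (suc t)))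
      outside : sumBelow (λ i → χ (at (s + (suc t + i)))) (len ∸ suc t) ≡ 0
      outside = sumBelow-zero (len ∸ suc t) _ (λ i i<rest → indicator-no
                  (run-is-all ends i (subst (suc t + i <_) (m+[n∸m]≡n (<⇒≤ 1+t<len)) (+-monoʳ-< (suc t) i<rest))) (Q? _))

    t≡0⊎t≡suc : t ≡ 0 ⊎ ∃ λ t′ → t ≡ suc t′
    t≡0⊎t≡suc with t
    ... | zero = inj₁ refl
    ... | suc t′ = inj₂ (t′ , refl)

    -- entering and leaving through the same end would make the run a single vertex
    -- whose two cycle-neighbours coincide
    ¬same-end : ∀ {a pa} → at s ≡ e a → at j ≡ pa → at (s + t) ≡ e a → at (s + suc t) ≡ pa → ⊥
    ¬same-end in≡ pin≡ out≡ pout≡ with t≡0⊎t≡suc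
    ... | inj₂ (_ , t≡) = 0≢1+n (trans (at-injective-window s 0 t (≤-<-trans z≤n t<len) t<len (trans at-s+0 (trans in≡ (sym out≡)))) t≡)
    ... | inj₁ t≡ = at-2+≢ j (trans (cong at (cong suc (+-comm 1 j))) (trans (cong (λ z → at (s + suc z)) (sym t≡)) (trans pout≡ (sym pin≡))))

    forwards : at s ≡ e x → at (s + t) ≡ e y → Traced
    forwards in≡ex out≡ey with t≡0⊎t≡suc
    ... | inj₁ t≡0 = ⊥-elim (x≢y (e-injective (trans (sym in≡ex) (trans (sym at-s+0) (trans (cong (λ z → at (s + z)) (sym t≡0)) out≡ey)))))
    ... | inj₂ (t′ , t≡) with path-from-walk (Adj G) f t′ (λ i i≤t′ → f-adj i (subst (i <_) (sym t≡) (s≤s i≤t′)))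
                               (λ i i′ i≤ i′≤ → f-injective i i′ (subst (i ≤_) (sym t≡) i≤) (subst (i′ ≤_) (sym t≡) i′≤))
    ...   | p , |p| rewrite f0 in≡ex | sym t≡ | ft out≡ey = p , trans (count-run ends) (cong suc (sym |p|))
      where
      ends : ∀ w → w ≡ e x ⊎ w ≡ e y → w ≡ at s ⊎ w ≡ at (s + t)
      ends w (inj₁ w≡ex) = inj₁ (trans w≡ex (sym in≡ex))
      ends w (inj₂ w≡ey) = inj₂ (trans w≡ey (sym out≡ey))

    backwards : at s ≡ e y → at (s + t) ≡ e x → Traced
    backwards in≡ey out≡ex with t≡0⊎t≡suc
    ... | inj₁ t≡0 = ⊥-elim (x≢y (e-injective (trans (sym out≡ex) (trans (cong (λ z → at (s + z)) t≡0) (trans at-s+0 in≡ey)))))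
    ... | inj₂ (t′ , t≡) with path-from-walk (Adj G) (λ i → f (t ∸ i)) t′ adj inj
      where
      adj : ∀ i → i ≤ t′ → Adj G (f (t ∸ i)) (f (t ∸ suc i))
      adj i i≤t′ = subst (λ z → Adj G (f z) (f (t ∸ suc i))) (sym t∸i≡) (Adj-sym G (f-adj (t ∸ suc i) t∸1+i<t))
        where
        t∸i≡ : t ∸ i ≡ suc (t ∸ suc i)
        t∸i≡ = trans (cong (_∸ i) t≡) (trans (+-∸-assoc 1 i≤t′) (cong (λ z → suc (z ∸ suc i)) (sym t≡)))
        t∸1+i<t : t ∸ suc i < t
        t∸1+i<t = subst (λ z → z ∸ suc i < z) (sym t≡) (s≤s (m∸n≤m t′ i))
      inj : ∀ i i′ → i ≤ suc t′ → i′ ≤ suc t′ → f (t ∸ i) ≡ f (t ∸ i′) → i ≡ i′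
      inj i i′ i≤ i′≤ eq = ∸-cancelˡ-≡ (subst (i ≤_) (sym t≡) i≤) (subst (i′ ≤_) (sym t≡) i′≤)
                             (f-injective _ _ (m∸n≤m t i) (m∸n≤m t i′) eq)
    ...   | p , |p| rewrite ft out≡ex | sym t≡ | n∸n≡0 t | f0 in≡ey = p , trans (count-run ends) (cong suc (sym |p|))
      where
      ends : ∀ w → w ≡ e x ⊎ w ≡ e y → w ≡ at s ⊎ w ≡ at (s + t)
      ends w (inj₁ w≡ex) = inj₂ (trans w≡ex (sym out≡ex))
      ends w (inj₂ w≡ey) = inj₁ (trans w≡ey (sym in≡ey))

    traced : Traced
    traced with enter | leave
    ... | inj₁ (in≡ex , _) | inj₂ (out≡ey , _) = forwards in≡ex out≡ey
    ... | inj₂ (in≡ey , _) | inj₁ (out≡ex , _) = backwards in≡ey out≡ex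
    ... | inj₁ (in≡ex , p) | inj₁ (out≡ex , p′) = ⊥-elim (¬same-end in≡ex p out≡ex p′)
    ... | inj₂ (in≡ey , p) | inj₂ (out≡ey , p′) = ⊥-elim (¬same-end in≡ey p out≡ey p′)

  trace : ∀ a b → Q (at a) → ¬ Q (at b) → Traced
  trace a b qa ¬qb with leaves (∁ Q) (∁? Q?) b a ¬qb (λ ¬q → ¬q qa)
  ... | j , ¬Qj , ¬¬Q1+j = Run.traced j ¬Qj (¬¬Q ¬¬Q1+j)

-- The graph G ⊗_N G

module Glued {n : ℕ} (G : Graph n) (x y : Fin n) (N : ℕ) where

  M : ℕ
  M = 3 * N

  Vert : Set
  Vert = TVertex n N

  Col : Set
  Col = Fin (suc M)

  lv : Bool → Col → Vert
  lv s i = inj₂ (inj₂ (s , i))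

  lv-injective : ∀ {s s′ i j} → lv s i ≡ lv s′ j → i ≡ j
  lv-injective refl = refl

  _~_ : Vert → Vert → Set
  _~_ = TAdj G x y N

  ~-sym : ∀ {a b} → a ~ b → b ~ a
  ~-sym (inj₁ e) = inj₂ e
  ~-sym (inj₂ e) = inj₁ e

  ~⇒Adj₁ : ∀ {a b} → inj₁ a ~ inj₁ b → Adj G a b
  ~⇒Adj₁ (inj₁ (in₁ a b a~b)) = a~b
  ~⇒Adj₁ (inj₂ (in₁ b a b~a)) = Adj-sym G b~a

  ~⇒Adj₂ : ∀ {a b} → inj₂ (inj₁ a) ~ inj₂ (inj₁ b) → Adj G a b
  ~⇒Adj₂ (inj₁ (in₂ a b a~b)) = a~b
  ~⇒Adj₂ (inj₂ (in₂ b a b~a)) = Adj-sym G b~a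

  _≟ᵥ_ : DecidableEquality Vert
  _≟ᵥ_ = Sum.≡-dec Fin._≟_ (Sum.≡-dec Fin._≟_ (Product.≡-dec Bool._≟_ Fin._≟_))

  In₁ In₂ InL : Vert → Set
  In₁ = InG₁ {n} {N}
  In₂ = InG₂ {n} {N}
  InL w = ∃ λ s → ∃ λ i → w ≡ lv s i

  InCol : ℕ → Vert → Set
  InCol c w = ∃ λ s → ∃ λ i → w ≡ lv s i × toℕ i ≡ c

  LeftOf : ℕ → Vert → Set
  LeftOf c w = In₁ w ⊎ (∃ λ s → ∃ λ i → w ≡ lv s i × toℕ i ≤ c)

  In₁? : Decidable In₁
  In₁? (inj₁ a) = yes (a , refl)
  In₁? (inj₂ w) = no λ { (a , ()) }

  In₂? : Decidable In₂
  In₂? (inj₁ a) = no λ { (a , ()) }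
  In₂? (inj₂ (inj₁ a)) = yes (a , refl)
  In₂? (inj₂ (inj₂ w)) = no λ { (a , ()) }

  InL? : Decidable InL
  InL? (inj₁ a) = no λ { (s , i , ()) }
  InL? (inj₂ (inj₁ a)) = no λ { (s , i , ()) }
  InL? (inj₂ (inj₂ (s , i))) = yes (s , i , refl)

  InCol? : ∀ c → Decidable (InCol c)
  InCol? c (inj₁ a) = no λ { (s , i , () , _) }
  InCol? c (inj₂ (inj₁ a)) = no λ { (s , i , () , _) }
  InCol? c (inj₂ (inj₂ (s , i))) with toℕ i ≟ c
  ... | yes e = yes (s , i , refl , e)
  ... | no ne = no λ { (.s , .i , refl , e) → ne e }

  LeftOf? : ∀ c → Decidable (LeftOf c)
  LeftOf? c (inj₁ a) = yes (inj₁ (a , refl))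
  LeftOf? c (inj₂ (inj₁ a)) = no λ { (inj₁ (_ , ())) ; (inj₂ (_ , _ , () , _)) }
  LeftOf? c (inj₂ (inj₂ (s , i))) with toℕ i ≤? c
  ... | yes le = yes (inj₂ (s , i , refl , le))
  ... | no nle = no λ { (inj₁ (_ , ())) ; (inj₂ (.s , .i , refl , le)) → nle le }

  M%3≡0 : M % 3 ≡ 0
  M%3≡0 = 3k%3≡0 N

  -- every column lies just left or just right of a gap crossed only by the two rails
  beside-gap : 0 < M → ∀ c → c ≤ M → (c < M × c % 3 ≢ 1) ⊎ (∃ λ c′ → c ≡ suc c′ × c′ < M × c′ % 3 ≢ 1)
  beside-gap 0<M c c≤M with %3-cases c | m≤n⇒m<n∨m≡n c≤M
  ... | inj₂ (inj₁ c≡1) | _ with %3≡1⇒suc c c≡1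
  ...   | c′ , refl = inj₂ (c′ , refl , c≤M , λ c′≡1 → contradiction (trans (sym (%3-suc c′ 1 c′≡1)) c≡1) λ ())
  beside-gap 0<M c c≤M | inj₁ c≡0 | inj₁ c<M = inj₁ (c<M , λ c≡1 → 0≢1+n (trans (sym c≡0) c≡1))
  beside-gap 0<M c c≤M | inj₂ (inj₂ c≡2) | inj₁ c<M = inj₁ (c<M , λ c≡1 → contradiction (trans (sym c≡2) c≡1) λ ())
  beside-gap 0<M c c≤M | inj₂ (inj₂ c≡2) | inj₂ refl = ⊥-elim (0≢1+n (trans (sym M%3≡0) c≡2))
  beside-gap 0<M c c≤M | inj₁ _ | inj₂ refl = inj₂ (M ∸ 1 , sym 1+[M∸1]≡M , ≤-reflexive 1+[M∸1]≡M , M∸1≢1)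
    where
    1+[M∸1]≡M : suc (M ∸ 1) ≡ M
    1+[M∸1]≡M = m+[n∸m]≡n 0<M
    M∸1≢1 : (M ∸ 1) % 3 ≢ 1
    M∸1≢1 e with trans (sym (trans (cong (_% 3) (sym 1+[M∸1]≡M)) (%3-suc (M ∸ 1) 1 e))) M%3≡0
    ... | ()

  -- The rungs leaving column i depend on i mod 3: straight across for 0, to the next
  -- column for 1, to the previous column for 2.
  RailOrRung : Bool → Col → Bool → Col → Set
  RailOrRung s i s′ j =
    (s′ ≡ s × (toℕ j ≡ suc (toℕ i) ⊎ suc (toℕ j) ≡ toℕ i)) ⊎
    (s′ ≡ not s × ((toℕ j ≡ toℕ i × toℕ i % 3 ≡ 0) ⊎ (toℕ i % 3 ≡ 1 × toℕ j ≡ suc (toℕ i)) ⊎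
                   (toℕ i % 3 ≡ 2 × suc (toℕ j) ≡ toℕ i)))

  LEdge⇒RailOrRung : ∀ {s i s′ j} → LEdge N (s , i) (s′ , j) → RailOrRung s i s′ j
  LEdge⇒RailOrRung (rail b i j e) = inj₁ (refl , inj₁ e)
  LEdge⇒RailOrRung (top i j ei ej) = inj₂ (refl , inj₁ (trans ej (sym ei) , trans (cong (_% 3) ei) M%3≡0))
  LEdge⇒RailOrRung (rung0 k i j _ ei ej) = inj₂ (refl , inj₁ (trans ej (sym ei) , trans (cong (_% 3) ei) (3k%3≡0 k)))
  LEdge⇒RailOrRung (rung1 k i j _ ei ej) =
    inj₂ (refl , inj₂ (inj₁ (trans (cong (_% 3) ei) ([3k+r]%3≡r k 1 (s≤s (s≤s z≤n))) ,
                             trans ej (trans (+-suc (3 * k) 1) (cong suc (sym ei))))))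
  LEdge⇒RailOrRung (rung2 k i j _ ei ej) =
    inj₂ (refl , inj₂ (inj₂ (trans (cong (_% 3) ei) ([3k+r]%3≡r k 2 (s≤s (s≤s (s≤s z≤n)))) ,
                             trans (cong suc ej) (trans (sym (+-suc (3 * k) 1)) (sym ei)))))

  LEdge⁻¹⇒RailOrRung : ∀ {s i s′ j} → LEdge N (s′ , j) (s , i) → RailOrRung s i s′ j
  LEdge⁻¹⇒RailOrRung (rail b j i e) = inj₁ (refl , inj₂ (sym e))
  LEdge⁻¹⇒RailOrRung (top j i ej ei) = inj₂ (refl , inj₁ (trans ej (sym ei) , trans (cong (_% 3) ei) M%3≡0))
  LEdge⁻¹⇒RailOrRung (rung0 k j i _ ej ei) = inj₂ (refl , inj₁ (trans ej (sym ei) , trans (cong (_% 3) ei) (3k%3≡0 k)))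
  LEdge⁻¹⇒RailOrRung (rung1 k j i _ ej ei) =
    inj₂ (refl , inj₂ (inj₂ (trans (cong (_% 3) ei) ([3k+r]%3≡r k 2 (s≤s (s≤s (s≤s z≤n)))) ,
                             trans (cong suc ej) (trans (sym (+-suc (3 * k) 1)) (sym ei)))))
  LEdge⁻¹⇒RailOrRung (rung2 k j i _ ej ei) =
    inj₂ (refl , inj₂ (inj₁ (trans (cong (_% 3) ei) ([3k+r]%3≡r k 1 (s≤s (s≤s z≤n))) ,
                             trans ej (trans (+-suc (3 * k) 1) (cong suc (sym ei))))))

  LadderNbr : Bool → Col → Vert → Set
  LadderNbr s i z = (∃ λ s′ → ∃ λ j → z ≡ lv s′ j × RailOrRung s i s′ j)
                  ⊎ (In₁ z × toℕ i ≡ 0) ⊎ (In₂ z × toℕ i ≡ M)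

  lv-nbr : ∀ {s i z} → lv s i ~ z → LadderNbr s i z
  lv-nbr (inj₁ (ladder _ (s′ , j) e)) = inj₁ (s′ , j , refl , LEdge⇒RailOrRung e)
  lv-nbr (inj₂ (ladder (s′ , j) _ e)) = inj₁ (s′ , j , refl , LEdge⁻¹⇒RailOrRung e)
  lv-nbr (inj₂ x₁u₀) = inj₂ (inj₁ ((x , refl) , refl))
  lv-nbr (inj₂ y₁v₀) = inj₂ (inj₁ ((y , refl) , refl))
  lv-nbr (inj₂ x₂u₃ₙ) = inj₂ (inj₂ ((x , refl) , toℕ-fromℕ M))
  lv-nbr (inj₂ y₂v₃ₙ) = inj₂ (inj₂ ((y , refl) , toℕ-fromℕ M))

  lv-nbr-1 : ∀ s i z → toℕ i % 3 ≡ 1 → lv s i ~ z →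
             (∃ λ j → z ≡ lv s j × suc (toℕ j) ≡ toℕ i) ⊎ (∃ λ s′ → ∃ λ j → z ≡ lv s′ j × toℕ j ≡ suc (toℕ i))
  lv-nbr-1 s i z r e with lv-nbr e
  ... | inj₁ (_ , j , refl , inj₁ (refl , inj₁ ej)) = inj₂ (s , j , refl , ej)
  ... | inj₁ (_ , j , refl , inj₁ (refl , inj₂ ej)) = inj₁ (j , refl , ej)
  ... | inj₁ (_ , j , refl , inj₂ (refl , inj₁ (_ , r0))) = ⊥-elim (0≢1+n (trans (sym r0) r))
  ... | inj₁ (_ , j , refl , inj₂ (refl , inj₂ (inj₁ (_ , ej)))) = inj₂ (not s , j , refl , ej)
  ... | inj₁ (_ , j , refl , inj₂ (refl , inj₂ (inj₂ (r2 , _)))) with trans (sym r2) r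
  ...   | ()
  lv-nbr-1 s i z r e | inj₂ (inj₁ (_ , i≡0)) = ⊥-elim (0≢1+n (trans (sym (cong (_% 3) i≡0)) r))
  lv-nbr-1 s i z r e | inj₂ (inj₂ (_ , i≡M)) = ⊥-elim (0≢1+n (trans (sym (trans (cong (_% 3) i≡M) M%3≡0)) r))

  lv-nbr-2 : ∀ s i z → toℕ i % 3 ≡ 2 → lv s i ~ z →
             (∃ λ s′ → ∃ λ j → z ≡ lv s′ j × suc (toℕ j) ≡ toℕ i) ⊎ (∃ λ j → z ≡ lv s j × toℕ j ≡ suc (toℕ i))
  lv-nbr-2 s i z r e with lv-nbr e
  ... | inj₁ (_ , j , refl , inj₁ (refl , inj₁ ej)) = inj₂ (j , refl , ej)
  ... | inj₁ (_ , j , refl , inj₁ (refl , inj₂ ej)) = inj₁ (s , j , refl , ej)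
  ... | inj₁ (_ , j , refl , inj₂ (refl , inj₁ (_ , r0))) = ⊥-elim (0≢1+n (trans (sym r0) r))
  ... | inj₁ (_ , j , refl , inj₂ (refl , inj₂ (inj₁ (r1 , _)))) with trans (sym r1) r
  ...   | ()
  lv-nbr-2 s i z r e | inj₁ (_ , j , refl , inj₂ (refl , inj₂ (inj₂ (_ , ej)))) = inj₁ (not s , j , refl , ej)
  lv-nbr-2 s i z r e | inj₂ (inj₁ (_ , i≡0)) = ⊥-elim (0≢1+n (trans (sym (cong (_% 3) i≡0)) r))
  lv-nbr-2 s i z r e | inj₂ (inj₂ (_ , i≡M)) = ⊥-elim (0≢1+n (trans (sym (trans (cong (_% 3) i≡M) M%3≡0)) r))

  private
    G₁-nbr-LeftOf : ∀ c a z → inj₁ a ~ z → LeftOf c z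
    G₁-nbr-LeftOf c a z (inj₁ (in₁ a b _)) = inj₁ (b , refl)
    G₁-nbr-LeftOf c a z (inj₁ x₁u₀) = inj₂ (false , fzero , refl , z≤n)
    G₁-nbr-LeftOf c a z (inj₁ y₁v₀) = inj₂ (true , fzero , refl , z≤n)
    G₁-nbr-LeftOf c a z (inj₂ (in₁ b a _)) = inj₁ (b , refl)

  column-cut : ∀ c → c < M → c % 3 ≢ 1 → (i i′ : Col) → toℕ i ≡ c → toℕ i′ ≡ suc c →
               ∀ w z → LeftOf c w → ¬ LeftOf c z → w ~ z →
               (w ≡ lv false i × z ≡ lv false i′) ⊎ (w ≡ lv true i × z ≡ lv true i′)
  column-cut c c<M c≢1 i i′ ei ei′ .(inj₁ a) z (inj₁ (a , refl)) ¬left e = ⊥-elim (¬left (G₁-nbr-LeftOf c a z e))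
  column-cut c c<M c≢1 i i′ ei ei′ .(lv s k) z (inj₂ (s , k , refl , k≤c)) ¬left e with lv-nbr e
  ... | inj₂ (inj₁ (z∈G₁ , _)) = ⊥-elim (¬left (inj₁ z∈G₁))
  ... | inj₂ (inj₂ (_ , k≡M)) = ⊥-elim (<⇒≱ c<M (subst (_≤ c) k≡M k≤c))
  ... | inj₁ (_ , j , refl , inj₁ (refl , inj₂ ej)) =
    ⊥-elim (¬left (inj₂ (s , j , refl , ≤-trans (n≤1+n _) (subst (_≤ c) (sym ej) k≤c))))
  ... | inj₁ (_ , j , refl , inj₂ (refl , inj₁ (ej , _))) =
    ⊥-elim (¬left (inj₂ (_ , j , refl , subst (_≤ c) (sym ej) k≤c)))
  ... | inj₁ (_ , j , refl , inj₂ (refl , inj₂ (inj₂ (_ , ej)))) =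
    ⊥-elim (¬left (inj₂ (_ , j , refl , ≤-trans (n≤1+n _) (subst (_≤ c) (sym ej) k≤c))))
  ... | inj₁ (_ , j , refl , inj₂ (refl , inj₂ (inj₁ (k%3≡1 , ej)))) with toℕ j ≤? c
  ...   | yes j≤c = ⊥-elim (¬left (inj₂ (_ , j , refl , j≤c)))
  ...   | no j≰c = ⊥-elim (c≢1 (subst (λ t → t % 3 ≡ 1) (≤-antisym k≤c (s≤s⁻¹ (subst (c <_) ej (≰⇒> j≰c)))) k%3≡1))
  column-cut c c<M c≢1 i i′ ei ei′ .(lv s k) z (inj₂ (s , k , refl , k≤c)) ¬left e
      | inj₁ (_ , j , refl , inj₁ (refl , inj₁ ej)) with toℕ j ≤? c
  ... | yes j≤c = ⊥-elim (¬left (inj₂ (_ , j , refl , j≤c)))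
  ... | no j≰c = rails s
    where
    k≡c : toℕ k ≡ c
    k≡c = ≤-antisym k≤c (s≤s⁻¹ (subst (c <_) ej (≰⇒> j≰c)))
    k≡i : k ≡ i
    k≡i = toℕ-injective (trans k≡c (sym ei))
    j≡i′ : j ≡ i′
    j≡i′ = toℕ-injective (trans ej (trans (cong suc k≡c) (sym ei′)))
    rails : ∀ s → (lv s k ≡ lv false i × lv s j ≡ lv false i′) ⊎ (lv s k ≡ lv true i × lv s j ≡ lv true i′)
    rails false = inj₁ (cong (lv false) k≡i , cong (lv false) j≡i′)
    rails true = inj₂ (cong (lv true) k≡i , cong (lv true) j≡i′)

  G₁-cut : ∀ w z → In₁ w → ¬ In₁ z → w ~ z →
           (w ≡ inj₁ x × z ≡ lv false fzero) ⊎ (w ≡ inj₁ y × z ≡ lv true fzero)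
  G₁-cut .(inj₁ a) z (a , refl) ¬in (inj₁ (in₁ a b _)) = ⊥-elim (¬in (b , refl))
  G₁-cut .(inj₁ _) z (_ , refl) ¬in (inj₁ x₁u₀) = inj₁ (refl , refl)
  G₁-cut .(inj₁ _) z (_ , refl) ¬in (inj₁ y₁v₀) = inj₂ (refl , refl)
  G₁-cut .(inj₁ a) z (a , refl) ¬in (inj₂ (in₁ b a _)) = ⊥-elim (¬in (b , refl))

  G₂-cut : ∀ w z → In₂ w → ¬ In₂ z → w ~ z →
           (w ≡ inj₂ (inj₁ x) × z ≡ lv false (fromℕ M)) ⊎ (w ≡ inj₂ (inj₁ y) × z ≡ lv true (fromℕ M))
  G₂-cut .(inj₂ (inj₁ a)) z (a , refl) ¬in (inj₁ (in₂ a b _)) = ⊥-elim (¬in (b , refl))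
  G₂-cut .(inj₂ (inj₁ _)) z (_ , refl) ¬in (inj₁ x₂u₃ₙ) = inj₁ (refl , refl)
  G₂-cut .(inj₂ (inj₁ _)) z (_ , refl) ¬in (inj₁ y₂v₃ₙ) = inj₂ (refl , refl)
  G₂-cut .(inj₂ (inj₁ a)) z (a , refl) ¬in (inj₂ (in₂ b a _)) = ⊥-elim (¬in (b , refl))

-- Cycles of G ⊗_N G column by column

module Columns {n : ℕ} (G : Graph n) (x y : Fin n) (N : ℕ) (C : Cycle (TAdj G x y N)) where
  open Glued G x y N public
  open CycleWalk _~_ C public

  ν : ℕ → ℕ
  ν c = count (InCol? c) verts

  ladderCount : ℕ
  ladderCount = sumBelow ν (suc M)

  length-by-part : ∀ ws → length ws ≡ count In₁? ws + count In₂? ws + count InL? ws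
  length-by-part [] = refl
  length-by-part (inj₁ a ∷ ws) = cong suc (length-by-part ws)
  length-by-part (inj₂ (inj₁ a) ∷ ws) =
    trans (cong suc (length-by-part ws)) (cong (_+ count InL? ws) (sym (+-suc (count In₁? ws) (count In₂? ws))))
  length-by-part (inj₂ (inj₂ w) ∷ ws) = trans (cong suc (length-by-part ws)) (sym (+-suc _ (count InL? ws)))

  count-InL≡sum : ∀ ws → count InL? ws ≡ sumBelow (λ c → count (InCol? c) ws) (suc M)
  count-InL≡sum [] = sym (sumBelow-zero (suc M) _ (λ _ _ → refl))
  count-InL≡sum (w ∷ ws) =
    trans (cong₂ _+_ (one-column w) (count-InL≡sum ws))
          (sym (sumBelow-distrib-+ (suc M) (λ c → indicator (InCol? c w)) (λ c → count (InCol? c) ws)))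
    where
    column-of : ∀ c s i → indicator (InCol? c (lv s i)) ≡ indicator (toℕ i ≟ c)
    column-of c s i with toℕ i ≟ c
    ... | yes _ = refl
    ... | no _ = refl
    one-column : ∀ w → indicator (InL? w) ≡ sumBelow (λ c → indicator (InCol? c w)) (suc M)
    one-column (inj₁ a) = sym (sumBelow-zero (suc M) _ (λ _ _ → refl))
    one-column (inj₂ (inj₁ a)) = sym (sumBelow-zero (suc M) _ (λ _ _ → refl))
    one-column (inj₂ (inj₂ (s , i))) =
      sym (trans (sumBelow-cong (suc M) (λ c _ → column-of c s i)) (sumBelow-indicator-≡ (toℕ i) (suc M) (toℕ<n i)))

  len≡ : len ≡ count In₁? verts + count In₂? verts + ladderCount
  len≡ = trans (sym length-verts)
               (trans (length-by-part verts) (cong (count In₁? verts + count In₂? verts +_) (count-InL≡sum verts)))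

  ν≡occurrences : ∀ c (i : Col) → toℕ i ≡ c → ∀ ws →
                  count (InCol? c) ws ≡ occurrences _≟ᵥ_ (lv false i) ws + occurrences _≟ᵥ_ (lv true i) ws
  ν≡occurrences c i e [] = refl
  ν≡occurrences c i e (w ∷ ws) =
    trans (cong₂ _+_ (one w) (ν≡occurrences c i e ws))
          (+-interchange (indicator (w ≟ᵥ lv false i)) (indicator (w ≟ᵥ lv true i))
                         (occurrences _≟ᵥ_ (lv false i) ws) (occurrences _≟ᵥ_ (lv true i) ws))
    where
    absent : ∀ w → w ≢ lv false i → w ≢ lv true i →
             indicator (w ≟ᵥ lv false i) + indicator (w ≟ᵥ lv true i) ≡ 0
    absent w ≢f ≢t = cong₂ _+_ (indicator-no ≢f (w ≟ᵥ lv false i)) (indicator-no ≢t (w ≟ᵥ lv true i))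
    one : ∀ w → indicator (InCol? c w) ≡ indicator (w ≟ᵥ lv false i) + indicator (w ≟ᵥ lv true i)
    one (inj₁ a) = sym (absent (inj₁ a) (λ ()) (λ ()))
    one (inj₂ (inj₁ a)) = sym (absent (inj₂ (inj₁ a)) (λ ()) (λ ()))
    one (inj₂ (inj₂ (s , k))) with toℕ k ≟ c
    ... | no k≢c = sym (absent (lv s k) (λ { refl → k≢c e }) (λ { refl → k≢c e }))
    ... | yes k≡c with toℕ-injective (trans k≡c (sym e))
    one (inj₂ (inj₂ (false , k))) | yes _ | refl =
      sym (cong₂ _+_ (indicator-yes refl (lv false k ≟ᵥ lv false k)) (indicator-no (λ ()) (lv false k ≟ᵥ lv true k)))
    one (inj₂ (inj₂ (true , k))) | yes _ | refl =
      sym (cong₂ _+_ (indicator-no (λ ()) (lv true k ≟ᵥ lv false k)) (indicator-yes refl (lv true k ≟ᵥ lv true k)))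

  private
    occ : Vert → ℕ
    occ a = occurrences _≟ᵥ_ a verts

    occ≤1 : ∀ a → occ a ≤ 1
    occ≤1 a = Unique⇒occurrences≤1 _≟ᵥ_ a verts (Cycle.unique C)

    occ≡0⊎∈ : ∀ a → occ a ≡ 0 ⊎ a ∈ verts
    occ≡0⊎∈ a with occ a in eq
    ... | zero = inj₁ refl
    ... | suc _ = inj₂ (occurrences>0⇒∈ _≟ᵥ_ a verts (subst (1 ≤_) (sym eq) (s≤s z≤n)))

  ν≤2 : ∀ c (i : Col) → toℕ i ≡ c → ν c ≤ 2
  ν≤2 c i e = subst (_≤ 2) (sym (ν≡occurrences c i e verts)) (+-mono-≤ (occ≤1 _) (occ≤1 _))

  both∈⇒ν≡2 : ∀ c (i : Col) → toℕ i ≡ c → lv false i ∈ verts → lv true i ∈ verts → ν c ≡ 2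
  both∈⇒ν≡2 c i e f∈ t∈ = ≤-antisym (ν≤2 c i e)
    (subst (2 ≤_) (sym (ν≡occurrences c i e verts))
      (+-mono-≤ (∈⇒occurrences>0 _≟ᵥ_ _ verts f∈) (∈⇒occurrences>0 _≟ᵥ_ _ verts t∈)))

  ¬both∈⇒ν≤1 : ∀ c (i : Col) → toℕ i ≡ c → ¬ (lv false i ∈ verts × lv true i ∈ verts) → ν c ≤ 1
  ¬both∈⇒ν≤1 c i e ¬both with occ≡0⊎∈ (lv false i) | occ≡0⊎∈ (lv true i)
  ... | inj₂ f∈ | inj₂ t∈ = ⊥-elim (¬both (f∈ , t∈))
  ... | inj₁ f0 | _ = subst (_≤ 1) (sym (trans (ν≡occurrences c i e verts) (cong (_+ occ (lv true i)) f0))) (occ≤1 _)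
  ... | inj₂ _ | inj₁ t0 =
    subst (_≤ 1) (sym (trans (ν≡occurrences c i e verts) (trans (cong (occ (lv false i) +_) t0) (+-identityʳ _)))) (occ≤1 _)

  ∈⇒ν>0 : ∀ c (i : Col) → toℕ i ≡ c → ∀ s → lv s i ∈ verts → 1 ≤ ν c
  ∈⇒ν>0 c i e false f∈ =
    subst (1 ≤_) (sym (ν≡occurrences c i e verts)) (≤-trans (∈⇒occurrences>0 _≟ᵥ_ _ verts f∈) (m≤m+n _ (occ (lv true i))))
  ∈⇒ν>0 c i e true t∈ =
    subst (1 ≤_) (sym (ν≡occurrences c i e verts)) (≤-trans (∈⇒occurrences>0 _≟ᵥ_ _ verts t∈) (m≤n+m _ (occ (lv false i))))

  ν≡0⇒∉ : ∀ (i : Col) → ν (toℕ i) ≡ 0 → ∀ s → lv s i ∉ verts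
  ν≡0⇒∉ i ν≡0 s s∈ = 1+n≰n (≤-trans (∈⇒ν>0 (toℕ i) i refl s s∈) (≤-reflexive ν≡0))

  col : ∀ c → c ≤ M → Col
  col c c≤M = fromℕ< (s≤s c≤M)

  toℕ-col : ∀ c (c≤M : c ≤ M) → toℕ (col c c≤M) ≡ c
  toℕ-col c c≤M = toℕ-fromℕ< (s≤s c≤M)

  ν>0⇒∈ : ∀ c → c ≤ M → 1 ≤ ν c → ∃ λ s → ∃ λ (i : Col) → toℕ i ≡ c × lv s i ∈ verts
  ν>0⇒∈ c c≤M ν>0 = choose (occ≡0⊎∈ (lv false i)) (occ≡0⊎∈ (lv true i))
    where
    i : Col
    i = col c c≤M
    choose : occ (lv false i) ≡ 0 ⊎ lv false i ∈ verts → occ (lv true i) ≡ 0 ⊎ lv true i ∈ verts →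
             ∃ λ s → ∃ λ (i : Col) → toℕ i ≡ c × lv s i ∈ verts
    choose (inj₂ f∈) _ = false , i , toℕ-col c c≤M , f∈
    choose (inj₁ _) (inj₂ t∈) = true , i , toℕ-col c c≤M , t∈
    choose (inj₁ f0) (inj₁ t0) =
      ⊥-elim (1+n≰n (≤-trans ν>0 (≤-reflexive (trans (ν≡occurrences c i (toℕ-col c c≤M) verts) (cong₂ _+_ f0 t0)))))

  ∈⇒∃at : ∀ {w} (P : Vert → Set) → w ∈ verts → P w → ∃ λ a → P (at a)
  ∈⇒∃at P w∈ pw with ∈⇒at w∈
  ... | a , refl = a , pw

  Crossing : ℕ → Set
  Crossing c = (∃ λ a → LeftOf c (at a)) × (∃ λ b → ¬ LeftOf c (at b))

  spanned⇒Crossing : ∀ c lo hi → lo ≤ c → c < hi → hi ≤ M → 1 ≤ ν lo → 1 ≤ ν hi → Crossing c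
  spanned⇒Crossing c lo hi lo≤c c<hi hi≤M ν-lo ν-hi
    with ν>0⇒∈ lo (≤-trans lo≤c (≤-trans (n≤1+n c) (≤-trans c<hi hi≤M))) ν-lo | ν>0⇒∈ hi hi≤M ν-hi
  ... | s , i , i≡lo , lo∈ | s′ , i′ , i′≡hi , hi∈ =
    ∈⇒∃at (LeftOf c) lo∈ (inj₂ (s , i , refl , subst (_≤ c) (sym i≡lo) lo≤c)) ,
    ∈⇒∃at (λ w → ¬ LeftOf c w) hi∈ right
    where
    right : ¬ LeftOf c (lv s′ i′)
    right (inj₁ (_ , ()))
    right (inj₂ (_ , _ , refl , i′≤c)) = <⇒≱ c<hi (subst (_≤ c) i′≡hi i′≤c)

  Crossing⇒rails : ∀ c (c<M : c < M) → c % 3 ≢ 1 → Crossing c →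
                   Nbr (lv false (col c (<⇒≤ c<M))) (lv false (col (suc c) c<M)) ×
                   Nbr (lv true (col c (<⇒≤ c<M))) (lv true (col (suc c) c<M))
  Crossing⇒rails c c<M c≢1 ((a , left) , (b , ¬left)) =
    two-edge-cut ~-sym (LeftOf c) (LeftOf? c) _ _ _ _
      (column-cut c c<M c≢1 _ _ (toℕ-col c (<⇒≤ c<M)) (toℕ-col (suc c) c<M)) a b left ¬left

  Crossing⇒full : ∀ c → c < M → c % 3 ≢ 1 → Crossing c → ν c ≡ 2 × ν (suc c) ≡ 2
  Crossing⇒full c c<M c≢1 crossing with Crossing⇒rails c c<M c≢1 crossing
  ... | false-rail , true-rail =
    both∈⇒ν≡2 c _ (toℕ-col c (<⇒≤ c<M)) (Nbr⇒∈ (Nbr-sym false-rail)) (Nbr⇒∈ (Nbr-sym true-rail)) ,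
    both∈⇒ν≡2 (suc c) _ (toℕ-col (suc c) c<M) (Nbr⇒∈ false-rail) (Nbr⇒∈ true-rail)

  Nbr⇒~ : ∀ {w z} → Nbr w z → w ~ z
  Nbr⇒~ nbr with Nbr⇒R nbr
  ... | inj₁ w~z = w~z
  ... | inj₂ z~w = ~-sym z~w

  forward-Nbrs : ∀ c (i i′ : Col) → toℕ i ≡ c → toℕ i′ ≡ suc c → c % 3 ≡ 1 →
                 (∀ s j → suc (toℕ j) ≡ c → lv s j ∉ verts) → ∀ s → lv s i ∈ verts →
                 Nbr (lv s i) (lv false i′) × Nbr (lv s i) (lv true i′)
  forward-Nbrs c i i′ ei ei′ r unused s s∈ = Nbrs-among (lv false i′) (lv true i′) s∈ among
    where
    among : ∀ z → Nbr (lv s i) z → z ≡ lv false i′ ⊎ z ≡ lv true i′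
    among z nbr with lv-nbr-1 s i z (trans (cong (_% 3) ei) r) (Nbr⇒~ nbr)
    ... | inj₁ (j , refl , ej) = ⊥-elim (unused s j (trans ej ei) (Nbr⇒∈ nbr))
    ... | inj₂ (false , j , refl , ej) = inj₁ (cong (lv false) (toℕ-injective (trans ej (trans (cong suc ei) (sym ei′)))))
    ... | inj₂ (true , j , refl , ej) = inj₂ (cong (lv true) (toℕ-injective (trans ej (trans (cong suc ei) (sym ei′)))))

  backward-Nbrs : ∀ c (i i′ : Col) → toℕ i ≡ suc c → toℕ i′ ≡ c → suc c % 3 ≡ 2 →
                  (∀ s j → toℕ j ≡ suc (suc c) → lv s j ∉ verts) → ∀ s → lv s i ∈ verts →
                  Nbr (lv s i) (lv false i′) × Nbr (lv s i) (lv true i′)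
  backward-Nbrs c i i′ ei ei′ r unused s s∈ = Nbrs-among (lv false i′) (lv true i′) s∈ among
    where
    among : ∀ z → Nbr (lv s i) z → z ≡ lv false i′ ⊎ z ≡ lv true i′
    among z nbr with lv-nbr-2 s i z (trans (cong (_% 3) ei) r) (Nbr⇒~ nbr)
    ... | inj₂ (j , refl , ej) = ⊥-elim (unused s j (trans ej (cong suc ei)) (Nbr⇒∈ nbr))
    ... | inj₁ (false , j , refl , ej) = inj₁ (cong (lv false) (toℕ-injective (suc-injective (trans ej (trans ei (sym (cong suc ei′)))))))
    ... | inj₁ (true , j , refl , ej) = inj₂ (cong (lv true) (toℕ-injective (suc-injective (trans ej (trans ei (sym (cong suc ei′)))))))

  record LadderSpan : Set where
    field
      m₀ m₁ : ℕ
      m₀≤m₁ : m₀ ≤ m₁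
      m₁≤M : m₁ ≤ M
      ν-m₀ : 1 ≤ ν m₀
      ν-m₁ : 1 ≤ ν m₁
      empty-below : ∀ c → c < m₀ → ν c ≡ 0
      empty-above : ∀ c → m₁ < c → c ≤ M → ν c ≡ 0

  ladderSpan : 1 ≤ ladderCount → LadderSpan
  ladderSpan 1≤count with sumBelow-positive ν (suc M) 1≤count
  ... | c , c≤M , ν-c with minimal (λ c → 1 ≤? ν c) c ν-c | maximal (λ c → 1 ≤? ν c) M c (s≤s⁻¹ c≤M) ν-c
  ...   | m₀ , m₀≤c , ν-m₀ , below | m₁ , c≤m₁ , m₁≤M , ν-m₁ , above = record
    { m₀ = m₀ ; m₁ = m₁ ; m₀≤m₁ = ≤-trans m₀≤c c≤m₁ ; m₁≤M = m₁≤M ; ν-m₀ = ν-m₀ ; ν-m₁ = ν-m₁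
    ; empty-below = λ c′ c′<m₀ → n<1⇒n≡0 (≰⇒> (below c′ c′<m₀))
    ; empty-above = λ c′ m₁<c′ c′≤M → n<1⇒n≡0 (≰⇒> (above c′ m₁<c′ c′≤M))
    }

  module Span (S : LadderSpan) where
    open LadderSpan S

    m₀≤M : m₀ ≤ M
    m₀≤M = ≤-trans m₀≤m₁ m₁≤M

    ∉-below : ∀ s j → toℕ j < m₀ → lv s j ∉ verts
    ∉-below s j j<m₀ = ν≡0⇒∉ j (empty-below _ j<m₀) s

    ∉-above : ∀ s j → m₁ < toℕ j → lv s j ∉ verts
    ∉-above s j m₁<j = ν≡0⇒∉ j (empty-above _ m₁<j (s≤s⁻¹ (toℕ<n j))) s

    interior-full : ∀ c → m₀ < c → c < m₁ → ν c ≡ 2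
    interior-full c m₀<c c<m₁ with beside-gap (≤-<-trans z≤n c<M) c (<⇒≤ c<M)
      where
      c<M : c < M
      c<M = <-≤-trans c<m₁ m₁≤M
    ... | inj₁ (c<M , c≢1) =
      proj₁ (Crossing⇒full c c<M c≢1 (spanned⇒Crossing c m₀ m₁ (<⇒≤ m₀<c) c<m₁ m₁≤M ν-m₀ ν-m₁))
    ... | inj₂ (c′ , refl , c′<M , c′≢1) =
      proj₂ (Crossing⇒full c′ c′<M c′≢1 (spanned⇒Crossing c′ m₀ m₁ (s≤s⁻¹ m₀<c) (<-trans (n<1+n c′) c<m₁) m₁≤M ν-m₀ ν-m₁))

    lowest≢2 : m₀ % 3 ≢ 2
    lowest≢2 m₀≡2 with ν>0⇒∈ m₀ m₀≤M ν-m₀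
    ... | s , i , i≡m₀ , s∈ = ¬unique-Nbr (lv s next) s∈ only
      where
      m₀<M : m₀ < M
      m₀<M = ≤∧≢⇒< m₀≤M (λ m₀≡M → 0≢1+n (trans (sym M%3≡0) (trans (cong (_% 3) (sym m₀≡M)) (trans m₀≡2 refl))))
      next : Col
      next = col (suc m₀) m₀<M
      only : ∀ z → Nbr (lv s i) z → z ≡ lv s next
      only z nbr with lv-nbr-2 s i z (trans (cong (_% 3) i≡m₀) m₀≡2) (Nbr⇒~ nbr)
      ... | inj₁ (_ , j , refl , ej) = ⊥-elim (∉-below _ j (subst (toℕ j <_) i≡m₀ (≤-reflexive ej)) (Nbr⇒∈ nbr))
      ... | inj₂ (j , refl , ej) = cong (lv s) (toℕ-injective (trans ej (trans (cong suc i≡m₀) (sym (toℕ-col (suc m₀) m₀<M)))))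

    highest≢1 : m₁ % 3 ≢ 1
    highest≢1 m₁≡1 with %3≡1⇒suc m₁ m₁≡1 | ν>0⇒∈ m₁ m₁≤M ν-m₁
    ... | c , m₁≡1+c | s , i , i≡m₁ , s∈ = ¬unique-Nbr (lv s previous) s∈ only
      where
      c≤M : c ≤ M
      c≤M = ≤-trans (n≤1+n c) (subst (_≤ M) m₁≡1+c m₁≤M)
      previous : Col
      previous = col c c≤M
      only : ∀ z → Nbr (lv s i) z → z ≡ lv s previous
      only z nbr with lv-nbr-1 s i z (trans (cong (_% 3) i≡m₁) m₁≡1) (Nbr⇒~ nbr)
      ... | inj₁ (j , refl , ej) =
        cong (lv s) (toℕ-injective (trans (suc-injective (trans ej (trans i≡m₁ m₁≡1+c))) (sym (toℕ-col c c≤M))))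
      ... | inj₂ (_ , j , refl , ej) = ⊥-elim (∉-above _ j (subst (m₁ <_) (sym ej) (s≤s (≤-reflexive (sym i≡m₁)))) (Nbr⇒∈ nbr))

    -- If both vertices of the lowest column m₀ ≡ 1 were used, each would continue into both
    -- vertices of column m₀ + 1, which also carry the rails to column m₀ + 2: three cycle-neighbours.
    lowest-single : m₀ % 3 ≡ 1 → suc (suc m₀) ≤ m₁ → ν m₀ ≤ 1
    lowest-single m₀≡1 2+m₀≤m₁ = ¬both∈⇒ν≤1 m₀ i (toℕ-col m₀ m₀≤M) ¬both
      where
      1+m₀<M : suc m₀ < M
      1+m₀<M = ≤-trans 2+m₀≤m₁ m₁≤M
      1+m₀≤M : suc m₀ ≤ M
      1+m₀≤M = <⇒≤ 1+m₀<M
      i i′ i″ : Col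
      i = col m₀ m₀≤M
      i′ = col (suc m₀) 1+m₀≤M
      i″ = col (suc (suc m₀)) 1+m₀<M
      1+m₀≢1 : suc m₀ % 3 ≢ 1
      1+m₀≢1 e with trans (sym (%3-suc m₀ 1 m₀≡1)) e
      ... | ()
      rails : Nbr (lv false i′) (lv false i″) × Nbr (lv true i′) (lv true i″)
      rails = Crossing⇒rails (suc m₀) 1+m₀<M 1+m₀≢1
                (spanned⇒Crossing (suc m₀) m₀ m₁ (n≤1+n m₀) 2+m₀≤m₁ m₁≤M ν-m₀ ν-m₁)
      onward : ∀ s → lv s i ∈ verts → Nbr (lv false i′) (lv s i)
      onward s s∈ = Nbr-sym (proj₁ (forward-Nbrs m₀ i i′ (toℕ-col m₀ m₀≤M) (toℕ-col (suc m₀) 1+m₀≤M) m₀≡1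
                                      (λ s j e → ∉-below s j (≤-reflexive e)) s s∈))
      ¬both : ¬ (lv false i ∈ verts × lv true i ∈ verts)
      ¬both (f∈ , t∈) =
        ¬three-Nbrs (onward false f∈) (onward true t∈) (proj₁ rails) (λ ()) (λ ()) (λ e → <⇒≢ (m<n+m m₀ {2} (s≤s z≤n))
          (trans (sym (toℕ-col m₀ m₀≤M)) (trans (cong toℕ (lv-injective e)) (toℕ-col (suc (suc m₀)) 1+m₀<M))))

    highest-single : m₁ % 3 ≡ 2 → suc (suc m₀) ≤ m₁ → ν m₁ ≤ 1
    highest-single m₁≡2 2+m₀≤m₁ with m₁ ∸ 2 | m+[n∸m]≡n {2} (≤-trans (s≤s (s≤s z≤n)) 2+m₀≤m₁)
    ... | c | 2+c≡m₁ = ¬both∈⇒ν≤1 m₁ i (toℕ-col m₁ m₁≤M) ¬both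
      where
      c<M : c < M
      c<M = ≤-trans (n≤1+n (suc c)) (subst (_≤ M) (sym 2+c≡m₁) m₁≤M)
      c≢1 : c % 3 ≢ 1
      c≢1 c≡1 with trans (sym (%3-suc (suc c) 2 (%3-suc c 1 c≡1))) (trans (cong (_% 3) 2+c≡m₁) m₁≡2)
      ... | ()
      i i′ i″ : Col
      i = col m₁ m₁≤M
      i′ = col (suc c) c<M
      i″ = col c (<⇒≤ c<M)
      rails : Nbr (lv false i″) (lv false i′) × Nbr (lv true i″) (lv true i′)
      rails = Crossing⇒rails c c<M c≢1
                (spanned⇒Crossing c m₀ m₁ (s≤s⁻¹ (s≤s⁻¹ (subst (suc (suc m₀) ≤_) (sym 2+c≡m₁) 2+m₀≤m₁)))
                                  (subst (c <_) 2+c≡m₁ (n≤1+n (suc c))) m₁≤M ν-m₀ ν-m₁)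
      backward : ∀ s → lv s i ∈ verts → Nbr (lv false i′) (lv s i)
      backward s s∈ = Nbr-sym (proj₁ (backward-Nbrs (suc c) i i′ (trans (toℕ-col m₁ m₁≤M) (sym 2+c≡m₁)) (toℕ-col (suc c) c<M)
                                        (trans (cong (_% 3) 2+c≡m₁) m₁≡2)
                                        (λ s j e → ∉-above s j (subst (_< toℕ j) 2+c≡m₁ (≤-reflexive (sym e)))) s s∈))
      ¬both : ¬ (lv false i ∈ verts × lv true i ∈ verts)
      ¬both (f∈ , t∈) =
        ¬three-Nbrs (backward false f∈) (backward true t∈) (Nbr-sym (proj₁ rails)) (λ ()) (λ ()) (λ e → <⇒≢ (m<n+m c {2} (s≤s z≤n))
          (sym (trans (sym (trans (toℕ-col m₁ m₁≤M) (sym 2+c≡m₁))) (trans (cong toℕ (lv-injective e)) (toℕ-col c (<⇒≤ c<M))))))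

    adjacent-full : m₀ % 3 ≡ 1 → m₁ ≡ suc m₀ → ν m₀ ≡ 2 × ν m₁ ≡ 2
    adjacent-full m₀≡1 m₁≡1+m₀ = lower , upper
      where
      1+m₀≤M : suc m₀ ≤ M
      1+m₀≤M = subst (_≤ M) m₁≡1+m₀ m₁≤M
      i i′ : Col
      i = col m₀ m₀≤M
      i′ = col (suc m₀) 1+m₀≤M
      upper : ν m₁ ≡ 2
      upper with ν>0⇒∈ m₀ m₀≤M ν-m₀
      ... | s , k , k≡m₀ , s∈ with forward-Nbrs m₀ k i′ k≡m₀ (toℕ-col (suc m₀) 1+m₀≤M) m₀≡1
                                     (λ s j e → ∉-below s j (≤-reflexive e)) s s∈
      ...   | to-f , to-t = subst (λ z → ν z ≡ 2) (sym m₁≡1+m₀)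
                              (both∈⇒ν≡2 (suc m₀) i′ (toℕ-col (suc m₀) 1+m₀≤M) (Nbr⇒∈ to-f) (Nbr⇒∈ to-t))
      lower : ν m₀ ≡ 2
      lower with ν>0⇒∈ m₁ m₁≤M ν-m₁
      ... | s , k , k≡m₁ , s∈ with backward-Nbrs m₀ k i (trans k≡m₁ m₁≡1+m₀) (toℕ-col m₀ m₀≤M) (%3-suc m₀ 1 m₀≡1)
                                     (λ s j e → ∉-above s j (subst (_< toℕ j) (sym m₁≡1+m₀) (≤-reflexive (sym e)))) s s∈
      ...   | to-f , to-t = both∈⇒ν≡2 m₀ i (toℕ-col m₀ m₀≤M) (Nbr⇒∈ to-f) (Nbr⇒∈ to-t)

    left-end : suc (suc m₀) ≤ m₁ → 3 ∣ ν m₀ + 1 + m₀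
    left-end 2+m₀≤m₁ = subst (λ z → 3 ∣ ν m₀ + 1 + z) (*-identityˡ m₀) (by-residue (%3-cases m₀))
      where
      m₀<m₁ : m₀ < m₁
      m₀<m₁ = ≤-trans (n≤1+n (suc m₀)) 2+m₀≤m₁
      by-residue : m₀ % 3 ≡ 0 ⊎ m₀ % 3 ≡ 1 ⊎ m₀ % 3 ≡ 2 → 3 ∣ ν m₀ + 1 + 1 * m₀
      by-residue (inj₁ m₀≡0) = ∣-by-residue (ν m₀ + 1) 1 m₀ 0 m₀≡0 (subst (λ v → 3 ∣ v + 1 + 0) (sym full) ∣-refl)
        where
        full : ν m₀ ≡ 2
        full = proj₁ (Crossing⇒full m₀ (≤-trans m₀<m₁ m₁≤M) (λ e → 0≢1+n (trans (sym m₀≡0) e))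
                        (spanned⇒Crossing m₀ m₀ m₁ ≤-refl m₀<m₁ m₁≤M ν-m₀ ν-m₁))
      by-residue (inj₂ (inj₁ m₀≡1)) = ∣-by-residue (ν m₀ + 1) 1 m₀ 1 m₀≡1 (subst (λ v → 3 ∣ v + 1 + 1) (sym single) ∣-refl)
        where
        single : ν m₀ ≡ 1
        single = ≤-antisym (lowest-single m₀≡1 2+m₀≤m₁) ν-m₀
      by-residue (inj₂ (inj₂ m₀≡2)) = ⊥-elim (lowest≢2 m₀≡2)

    right-end : suc (suc m₀) ≤ m₁ → 3 ∣ ν m₁ + 1 + 2 * m₁
    right-end 2+m₀≤m₁ = by-residue (%3-cases m₁)
      where
      by-residue : m₁ % 3 ≡ 0 ⊎ m₁ % 3 ≡ 1 ⊎ m₁ % 3 ≡ 2 → 3 ∣ ν m₁ + 1 + 2 * m₁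
      by-residue (inj₁ m₁≡0) = ∣-by-residue (ν m₁ + 1) 2 m₁ 0 m₁≡0 (subst (λ v → 3 ∣ v + 1 + 0) (sym full) ∣-refl)
        where
        full : ν m₁ ≡ 2
        full with m₁ ∸ 1 | m+[n∸m]≡n {1} (≤-trans (s≤s z≤n) 2+m₀≤m₁)
        ... | c | 1+c≡m₁ = subst (λ z → ν z ≡ 2) 1+c≡m₁
          (proj₂ (Crossing⇒full c (subst (_≤ M) (sym 1+c≡m₁) m₁≤M) c≢1
            (spanned⇒Crossing c m₀ m₁ (≤-trans (n≤1+n m₀) (s≤s⁻¹ (subst (suc (suc m₀) ≤_) (sym 1+c≡m₁) 2+m₀≤m₁)))
                              (≤-reflexive 1+c≡m₁) m₁≤M ν-m₀ ν-m₁)))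
          where
          c≢1 : c % 3 ≢ 1
          c≢1 c≡1 with trans (sym (%3-suc c 1 c≡1)) (trans (cong (_% 3) 1+c≡m₁) m₁≡0)
          ... | ()
      by-residue (inj₂ (inj₁ m₁≡1)) = ⊥-elim (highest≢1 m₁≡1)
      by-residue (inj₂ (inj₂ m₁≡2)) = ∣-by-residue (ν m₁ + 1) 2 m₁ 2 m₁≡2 (subst (λ v → 3 ∣ v + 1 + 4) (sym single) (divides 2 refl))
        where
        single : ν m₁ ≡ 1
        single = ≤-antisym (highest-single m₁≡2 2+m₀≤m₁) ν-m₁

    ladderCount-from-m₀ : ∀ k → m₁ ≡ m₀ + k → ladderCount ≡ sumBelow (λ i → ν (m₀ + i)) k + ν m₁
    ladderCount-from-m₀ k m₁≡ = begin
      sumBelow ν (suc M)                                          ≡⟨ cong (sumBelow ν) 1+M≡ ⟩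
      sumBelow ν (m₀ + (k + suc r))                               ≡⟨ sumBelow-+ m₀ (k + suc r) ν ⟩
      sumBelow ν m₀ + sumBelow (λ i → ν (m₀ + i)) (k + suc r)    ≡⟨ cong (_+ sumBelow (λ i → ν (m₀ + i)) (k + suc r)) (sumBelow-zero m₀ ν empty-below) ⟩
      sumBelow (λ i → ν (m₀ + i)) (k + suc r)                     ≡⟨ sumBelow-+ k (suc r) (λ i → ν (m₀ + i)) ⟩
      run + (ν (m₀ + (k + 0)) + sumBelow (λ i → ν (m₀ + (k + suc i))) r)
                                                                  ≡⟨ cong (λ z → run + (ν z + rest)) (trans (cong (m₀ +_) (+-identityʳ k)) (sym m₁≡)) ⟩
      run + (ν m₁ + sumBelow (λ i → ν (m₀ + (k + suc i))) r)     ≡⟨ cong (λ z → run + (ν m₁ + z)) (sumBelow-zero r _ beyond) ⟩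
      run + (ν m₁ + 0)                                            ≡⟨ cong (run +_) (+-identityʳ (ν m₁)) ⟩
      run + ν m₁                                                  ∎
      where
      open ≡-Reasoning
      run : ℕ
      run = sumBelow (λ i → ν (m₀ + i)) k
      r : ℕ
      r = M ∸ m₁
      rest : ℕ
      rest = sumBelow (λ i → ν (m₀ + (k + suc i))) r
      1+M≡ : suc M ≡ m₀ + (k + suc r)
      1+M≡ = trans (cong suc (sym (m+[n∸m]≡n m₁≤M))) (trans (sym (+-suc m₁ r)) (trans (cong (_+ suc r) m₁≡) (+-assoc m₀ k (suc r))))
      beyond : ∀ i → i < r → ν (m₀ + (k + suc i)) ≡ 0
      beyond i i<r = trans (cong ν (trans (sym (+-assoc m₀ k (suc i))) (cong (_+ suc i) (sym m₁≡))))
                           (empty-above _ (m<m+n m₁ (s≤s z≤n)) (subst (m₁ + suc i ≤_) (m+[n∸m]≡n m₁≤M) (+-monoʳ-≤ m₁ i<r)))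

    ladderCount-single : m₀ ≡ m₁ → ladderCount ≡ ν m₀
    ladderCount-single m₀≡m₁ = trans (ladderCount-from-m₀ 0 (trans (sym m₀≡m₁) (sym (+-identityʳ m₀)))) (cong ν (sym m₀≡m₁))

    ladderCount-run : ∀ d → m₁ ≡ suc (m₀ + d) → ladderCount ≡ ν m₀ + 2 * d + ν m₁
    ladderCount-run d m₁≡ = trans (ladderCount-from-m₀ (suc d) (trans m₁≡ (sym (+-suc m₀ d))))
      (cong (_+ ν m₁) (cong₂ _+_ (cong ν (+-identityʳ m₀))
        (trans (sumBelow-cong d (λ i i<d → interior-full (m₀ + suc i) (m<m+n m₀ (s≤s z≤n)) (inside i i<d)))
               (trans (sumBelow-const d 2) (*-comm d 2)))))
      where
      inside : ∀ i → i < d → m₀ + suc i < m₁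
      inside i i<d = subst (m₀ + suc i <_) (sym m₁≡) (subst (_< suc (m₀ + d)) (sym (+-suc m₀ i)) (s≤s (+-monoʳ-< m₀ i<d)))

    adjacent⇒m₀≡1 : m₁ ≡ suc m₀ → m₀ % 3 ≡ 1
    adjacent⇒m₀≡1 m₁≡1+m₀ with %3-cases m₀
    ... | inj₁ m₀≡0 = ⊥-elim (highest≢1 (trans (cong (_% 3) m₁≡1+m₀) (%3-suc m₀ 0 m₀≡0)))
    ... | inj₂ (inj₁ m₀≡1) = m₀≡1
    ... | inj₂ (inj₂ m₀≡2) = ⊥-elim (lowest≢2 m₀≡2)

    ladderCount-run-∣ : ∀ d → m₁ ≡ suc (m₀ + suc d) → 3 ∣ suc ladderCount
    ladderCount-run-∣ d m₁≡ = subst (λ z → 3 ∣ suc z) (sym (ladderCount-run (suc d) m₁≡))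
      (ladder-sum-∣ (ν m₀) (ν m₁) m₀ (suc d) (left-end 2+m₀≤m₁) (subst (λ z → 3 ∣ ν m₁ + 1 + 2 * z) m₁≡ (right-end 2+m₀≤m₁)))
      where
      2+m₀≤m₁ : suc (suc m₀) ≤ m₁
      2+m₀≤m₁ = subst (suc (suc m₀) ≤_) (sym m₁≡) (s≤s (subst (suc m₀ ≤_) (sym (+-suc m₀ d)) (s≤s (m≤m+n m₀ d))))

    ladderCount-∤ : ¬ 3 ∣ ladderCount
    ladderCount-∤ with ≤-split m₀≤m₁
    ... | inj₁ m₀≡m₁ = subst (λ z → ¬ 3 ∣ z) (sym (ladderCount-single m₀≡m₁))
                         (3∤1≤n≤2 (ν m₀) ν-m₀ (ν≤2 m₀ (col m₀ m₀≤M) (toℕ-col m₀ m₀≤M)))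
    ... | inj₂ (inj₁ m₁≡1+m₀) = subst (λ z → ¬ 3 ∣ z) (sym four) 3∤4
      where
      four : ladderCount ≡ 4
      four = trans (ladderCount-run 0 (trans m₁≡1+m₀ (cong suc (sym (+-identityʳ m₀)))))
                   (cong₂ (λ u v → u + 0 + v) (proj₁ full) (proj₂ full))
        where
        full : ν m₀ ≡ 2 × ν m₁ ≡ 2
        full = adjacent-full (adjacent⇒m₀≡1 m₁≡1+m₀) m₁≡1+m₀
    ... | inj₂ (inj₂ (d , m₁≡)) = λ 3∣ → 3∣n⇒3∤1+n ladderCount 3∣ (ladderCount-run-∣ d m₁≡)

    -- a full end column ≡ 0 (mod 3) rules out the short shapes m₀ = m₁ with ν m₀ = 1 and m₁ = m₀ + 1
    ladderCount-∣ : (ν m₀ ≡ 2 × m₀ % 3 ≡ 0) ⊎ (ν m₁ ≡ 2 × m₁ % 3 ≡ 0) → 3 ∣ suc ladderCount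
    ladderCount-∣ full-end with ≤-split m₀≤m₁
    ... | inj₁ m₀≡m₁ = subst (λ z → 3 ∣ suc z) (sym (trans (ladderCount-single m₀≡m₁) (two full-end))) ∣-refl
      where
      two : (ν m₀ ≡ 2 × m₀ % 3 ≡ 0) ⊎ (ν m₁ ≡ 2 × m₁ % 3 ≡ 0) → ν m₀ ≡ 2
      two (inj₁ (ν≡2 , _)) = ν≡2
      two (inj₂ (ν≡2 , _)) = trans (cong ν m₀≡m₁) ν≡2
    ... | inj₂ (inj₁ m₁≡1+m₀) = ⊥-elim (short full-end)
      where
      m₀≡1 : m₀ % 3 ≡ 1
      m₀≡1 = adjacent⇒m₀≡1 m₁≡1+m₀
      short : (ν m₀ ≡ 2 × m₀ % 3 ≡ 0) ⊎ (ν m₁ ≡ 2 × m₁ % 3 ≡ 0) → ⊥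
      short (inj₁ (_ , m₀≡0)) = 0≢1+n (trans (sym m₀≡0) m₀≡1)
      short (inj₂ (_ , m₁≡0)) with trans (sym (trans (cong (_% 3) m₁≡1+m₀) (%3-suc m₀ 1 m₀≡1))) m₁≡0
      ... | ()
    ... | inj₂ (inj₂ (d , m₁≡)) = ladderCount-run-∣ d m₁≡

module Classification {n : ℕ} (G : Graph n) (x y : Fin n) (x≢y : x ≢ y) (N : ℕ) (C : Cycle (TAdj G x y N)) where
  open Columns G x y N C

  copy₂ : Fin n → Vert
  copy₂ a = inj₂ (inj₁ a)

  copy₂-injective : ∀ {a b} → copy₂ a ≡ copy₂ b → a ≡ b
  copy₂-injective refl = refl

  inj₁∈G₁ : ∀ a → In₁ (inj₁ a)
  inj₁∈G₁ a = a , refl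

  copy₂∈G₂ : ∀ a → In₂ (copy₂ a)
  copy₂∈G₂ a = a , refl

  module Trace₁ = Trace _~_ ~-sym C G x y x≢y inj₁ inj₁-injective ~⇒Adj₁ In₁ In₁? id inj₁∈G₁
                        (lv false fzero) (lv true fzero) G₁-cut
  module Trace₂ = Trace _~_ ~-sym C G x y x≢y copy₂ copy₂-injective ~⇒Adj₂ In₂ In₂? id copy₂∈G₂
                        (lv false (fromℕ M)) (lv true (fromℕ M)) G₂-cut

  G₁-ports : ∀ a b → In₁ (at a) → ¬ In₁ (at b) → Nbr (inj₁ x) (lv false fzero) × Nbr (inj₁ y) (lv true fzero)
  G₁-ports = two-edge-cut ~-sym In₁ In₁? _ _ _ _ G₁-cut

  G₂-ports : ∀ a b → In₂ (at a) → ¬ In₂ (at b) →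
             Nbr (inj₂ (inj₁ x)) (lv false (fromℕ M)) × Nbr (inj₂ (inj₁ y)) (lv true (fromℕ M))
  G₂-ports = two-edge-cut ~-sym In₂ In₂? _ _ _ _ G₂-cut

  count>0⇒at : ∀ {P : Vert → Set} (P? : Decidable P) → 1 ≤ count P? verts → ∃ λ a → P (at a)
  count>0⇒at {P} P? count>0 with count>0⇒∃ P? verts count>0
  ... | w , w∈ , pw = ∈⇒∃at P w∈ pw

  ≡suc⇒>0 : ∀ {k m} → k ≡ suc m → 1 ≤ k
  ≡suc⇒>0 refl = s≤s z≤n

  ¬In₁-L : ∀ {w} → InL w → ¬ In₁ w
  ¬In₁-L (_ , _ , refl) (_ , ())

  ¬In₂-L : ∀ {w} → InL w → ¬ In₂ w
  ¬In₂-L (_ , _ , refl) (_ , ())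

  ¬In₁-In₂ : ∀ {w} → In₂ w → ¬ In₁ w
  ¬In₁-In₂ (_ , refl) (_ , ())

  no-ladder : count InL? verts ≡ 0 → All In₁ verts ⊎ All In₂ verts
  no-ladder no-L with count In₁? verts in c₁
  ... | zero = inj₂ (tabulate (λ {w} w∈ → to-G₂ w (count≡0⇒¬ In₁? verts c₁ w∈) (count≡0⇒¬ InL? verts no-L w∈)))
    where
    to-G₂ : ∀ w → ¬ In₁ w → ¬ InL w → In₂ w
    to-G₂ (inj₁ a) ¬inG₁ _ = ⊥-elim (¬inG₁ (a , refl))
    to-G₂ (inj₂ (inj₁ a)) _ _ = a , refl
    to-G₂ (inj₂ (inj₂ (s , i))) _ ¬inL = ⊥-elim (¬inL (s , i , refl))
  ... | suc _ with count>0⇒at In₁? (≡suc⇒>0 c₁)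
  ...   | a , inG₁ = inj₁ (tabulate all-G₁)
    where
    all-G₁ : ∀ {w} → w ∈ verts → In₁ w
    all-G₁ {w} w∈ with In₁? w
    ... | yes q = q
    ... | no ¬q with ∈⇒∃at (λ z → ¬ In₁ z) w∈ ¬q
    ...   | b , ¬inG₁ = ⊥-elim (count≡0⇒¬ InL? verts no-L (Nbr⇒∈ (proj₁ (G₁-ports a b inG₁ ¬inG₁))) (false , fzero , refl))

  -- A cycle through both copies of G crosses every gap of the ladder, so every column is full.
  gaps-crossed : ∀ a b → In₁ (at a) → In₂ (at b) → ∀ c → c < M → c % 3 ≢ 1 → ν c ≡ 2 × ν (suc c) ≡ 2
  gaps-crossed a b inG₁ inG₂ c c<M c≢1 = Crossing⇒full c c<M c≢1 ((a , inj₁ inG₁) , (b , right))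
    where
    right : ¬ LeftOf c (at b)
    right (inj₁ inG₁′) = ¬In₁-In₂ inG₂ inG₁′
    right (inj₂ (_ , _ , at-b≡ , _)) = ¬In₂-L (_ , _ , at-b≡) inG₂

  all-columns-full : 1 ≤ N → ∀ a b → In₁ (at a) → In₂ (at b) → ∀ c → c ≤ M → ν c ≡ 2
  all-columns-full 1≤N a b inG₁ inG₂ c c≤M with beside-gap (≤-trans (s≤s z≤n) (*-monoʳ-≤ 3 1≤N)) c c≤M
  ... | inj₁ (c<M , c≢1) = proj₁ (gaps-crossed a b inG₁ inG₂ c c<M c≢1)
  ... | inj₂ (c′ , refl , c′<M , c′≢1) = proj₂ (gaps-crossed a b inG₁ inG₂ c′ c′<M c′≢1)

  through-both : 1 ≤ N → ∀ a b → In₁ (at a) → In₂ (at b) →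
                 Σ (Path (Adj G) x y) λ p₁ → Σ (Path (Adj G) x y) λ p₂ →
                   len ≡ 6 * N + 4 + pathLength (Adj G) p₁ + pathLength (Adj G) p₂
  through-both 1≤N a b inG₁ inG₂ = p₁ , p₂ , (begin
    len                                                  ≡⟨ len≡ ⟩
    count In₁? verts + count In₂? verts + ladderCount    ≡⟨ cong₂ _+_ (cong₂ _+_ (proj₂ traced₁) (proj₂ traced₂)) full ⟩
    suc l₁ + suc l₂ + suc M * 2                          ≡⟨ arithmetic l₁ l₂ N ⟩
    6 * N + 4 + l₁ + l₂                                  ∎)
    where
    open ≡-Reasoning
    traced₁ : Trace₁.Traced
    traced₁ = Trace₁.trace a b inG₁ (¬In₁-In₂ inG₂)
    traced₂ : Trace₂.Traced
    traced₂ = Trace₂.trace b a inG₂ (λ inG₂′ → ¬In₁-In₂ inG₂′ inG₁)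
    p₁ p₂ : Path (Adj G) x y
    p₁ = proj₁ traced₁
    p₂ = proj₁ traced₂
    l₁ l₂ : ℕ
    l₁ = pathLength (Adj G) p₁
    l₂ = pathLength (Adj G) p₂
    full : ladderCount ≡ suc M * 2
    full = trans (sumBelow-cong (suc M) (λ c c<1+M → all-columns-full 1≤N a b inG₁ inG₂ c (s≤s⁻¹ c<1+M)))
                 (sumBelow-const (suc M) 2)
    arithmetic : ∀ l₁ l₂ N → suc l₁ + suc l₂ + suc (3 * N) * 2 ≡ 6 * N + 4 + l₁ + l₂
    arithmetic = solve 3 (λ l₁ l₂ N → (con 1 :+ l₁) :+ (con 1 :+ l₂) :+ (con 1 :+ con 3 :* N) :* con 2
                                       := con 6 :* N :+ con 4 :+ l₁ :+ l₂) refl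
      where open +-*-Solver

  module _ (no-3∣-path : ∀ (p : Path (Adj G) x y) → ¬ 3 ∣ pathLength (Adj G) p) (3∣len : 3 ∣ len)
           (S : LadderSpan) where

    open LadderSpan S
    open Span S

    ¬only-G₁ : ∀ a b → In₁ (at a) → InL (at b) → count In₂? verts ≡ 0 → ⊥
    ¬only-G₁ a b inG₁ inL no-G₂ = impossible (proj₁ traced) (proj₂ traced)
      where
      traced : Trace₁.Traced
      traced = Trace₁.trace a b inG₁ (¬In₁-L inL)
      ports : Nbr (inj₁ x) (lv false fzero) × Nbr (inj₁ y) (lv true fzero)
      ports = G₁-ports a b inG₁ (¬In₁-L inL)
      ν0≡2 : ν 0 ≡ 2
      ν0≡2 = both∈⇒ν≡2 0 fzero refl (Nbr⇒∈ (proj₁ ports)) (Nbr⇒∈ (proj₂ ports))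
      m₀≡0 : m₀ ≡ 0
      m₀≡0 = n≤0⇒n≡0 (≮⇒≥ λ 0<m₀ → 0≢1+n (trans (sym (empty-below 0 0<m₀)) ν0≡2))
      3∣1+ladderCount : 3 ∣ suc ladderCount
      3∣1+ladderCount = ladderCount-∣ (inj₁ (subst (λ z → ν z ≡ 2 × z % 3 ≡ 0) (sym m₀≡0) (ν0≡2 , refl)))
      impossible : ∀ (p : Path (Adj G) x y) → count In₁? verts ≡ suc (pathLength (Adj G) p) → ⊥
      impossible p count₁ = no-3∣-path p (3∣1+l+n⇒3∣l (pathLength (Adj G) p) ladderCount 3∣ 3∣1+ladderCount)
        where
        3∣ : 3 ∣ suc (pathLength (Adj G) p) + ladderCount
        3∣ = subst (3 ∣_) (begin
          len                                                   ≡⟨ len≡ ⟩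
          count In₁? verts + count In₂? verts + ladderCount     ≡⟨ cong₂ (λ u v → u + v + ladderCount) count₁ no-G₂ ⟩
          suc (pathLength (Adj G) p) + 0 + ladderCount          ≡⟨ cong (_+ ladderCount) (+-identityʳ (suc (pathLength (Adj G) p))) ⟩
          suc (pathLength (Adj G) p) + ladderCount              ∎) 3∣len
          where open ≡-Reasoning

    ¬only-G₂ : ∀ a b → In₂ (at a) → InL (at b) → count In₁? verts ≡ 0 → ⊥
    ¬only-G₂ a b inG₂ inL no-G₁ = impossible (proj₁ traced) (proj₂ traced)
      where
      traced : Trace₂.Traced
      traced = Trace₂.trace a b inG₂ (¬In₂-L inL)
      ports : Nbr (inj₂ (inj₁ x)) (lv false (fromℕ M)) × Nbr (inj₂ (inj₁ y)) (lv true (fromℕ M))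
      ports = G₂-ports a b inG₂ (¬In₂-L inL)
      νM≡2 : ν M ≡ 2
      νM≡2 = both∈⇒ν≡2 M (fromℕ M) (toℕ-fromℕ M) (Nbr⇒∈ (proj₁ ports)) (Nbr⇒∈ (proj₂ ports))
      m₁≡M : m₁ ≡ M
      m₁≡M = ≤-antisym m₁≤M (≮⇒≥ λ m₁<M → 0≢1+n (trans (sym (empty-above M m₁<M ≤-refl)) νM≡2))
      3∣1+ladderCount : 3 ∣ suc ladderCount
      3∣1+ladderCount = ladderCount-∣ (inj₂ (subst (λ z → ν z ≡ 2 × z % 3 ≡ 0) (sym m₁≡M) (νM≡2 , M%3≡0)))
      impossible : ∀ (p : Path (Adj G) x y) → count In₂? verts ≡ suc (pathLength (Adj G) p) → ⊥
      impossible p count₂ = no-3∣-path p (3∣1+l+n⇒3∣l (pathLength (Adj G) p) ladderCount 3∣ 3∣1+ladderCount)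
        where
        3∣ : 3 ∣ suc (pathLength (Adj G) p) + ladderCount
        3∣ = subst (3 ∣_) (begin
          len                                                   ≡⟨ len≡ ⟩
          count In₁? verts + count In₂? verts + ladderCount     ≡⟨ cong₂ (λ u v → u + v + ladderCount) no-G₁ count₂ ⟩
          suc (pathLength (Adj G) p) + ladderCount              ∎) 3∣len
          where open ≡-Reasoning

    ¬only-ladder : count In₁? verts ≡ 0 → count In₂? verts ≡ 0 → ⊥
    ¬only-ladder no-G₁ no-G₂ =
      ladderCount-∤ (subst (3 ∣_) (trans len≡ (cong₂ (λ u v → u + v + ladderCount) no-G₁ no-G₂)) 3∣len)

  ladderSpanOf : 1 ≤ count InL? verts → LadderSpan
  ladderSpanOf some-ladder = ladderSpan (subst (1 ≤_) (count-InL≡sum verts) some-ladder)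

  Classified : Set
  Classified = All In₁ verts ⊎ All In₂ verts ⊎
               Σ (Path (Adj G) x y) λ p₁ → Σ (Path (Adj G) x y) λ p₂ →
                 len ≡ 6 * N + 4 + pathLength (Adj G) p₁ + pathLength (Adj G) p₂

  classify-ladder : 1 ≤ N → (∀ (p : Path (Adj G) x y) → ¬ 3 ∣ pathLength (Adj G) p) → 3 ∣ len →
                    1 ≤ count InL? verts → Classified
  classify-ladder 1≤N no-3∣-path 3∣len some-ladder
    with count>0⇒at InL? some-ladder | count In₁? verts in c₁ | count In₂? verts in c₂
  ... | b , inL | zero | zero = ⊥-elim (¬only-ladder no-3∣-path 3∣len (ladderSpanOf some-ladder) c₁ c₂)
  ... | b , inL | zero | suc _ with count>0⇒at In₂? (≡suc⇒>0 c₂)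
  ...   | a , inG₂ = ⊥-elim (¬only-G₂ no-3∣-path 3∣len (ladderSpanOf some-ladder) a b inG₂ inL c₁)
  classify-ladder 1≤N no-3∣-path 3∣len some-ladder | b , inL | suc _ | zero with count>0⇒at In₁? (≡suc⇒>0 c₁)
  ...   | a , inG₁ = ⊥-elim (¬only-G₁ no-3∣-path 3∣len (ladderSpanOf some-ladder) a b inG₁ inL c₂)
  classify-ladder 1≤N no-3∣-path 3∣len some-ladder | _ | suc _ | suc _
    with count>0⇒at In₁? (≡suc⇒>0 c₁) | count>0⇒at In₂? (≡suc⇒>0 c₂)
  ...   | a , inG₁ | b , inG₂ = inj₂ (inj₂ (through-both 1≤N a b inG₁ inG₂))

  classify : 1 ≤ N → (∀ (p : Path (Adj G) x y) → ¬ 3 ∣ pathLength (Adj G) p) → 3 ∣ len → Classified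
  classify 1≤N no-3∣-path 3∣len with count InL? verts in cL
  ... | zero = map₂ inj₁ (no-ladder cL)
  ... | suc _ = classify-ladder 1≤N no-3∣-path 3∣len (≡suc⇒>0 cL)

lemma6p3 : (N : ℕ) → 1 ≤ N → (n : ℕ) → (G : Graph n) → TwoConnected G →
    (x y : Fin n) → x ≢ y → degree G x ≡ 2 → degree G y ≡ 2 →
    (∀ v → v ≢ x → v ≢ y → degree G v ≡ 3) →
    (∀ (p : Path (Adj G) x y) → ¬ (3 ∣ pathLength (Adj G) p)) →
    (C : Cycle (TAdj G x y N)) → 3 ∣ cycleLength (TAdj G x y N) C →
    All (InG₁ {n} {N}) (cycleVertices (TAdj G x y N) C)
    ⊎ All (InG₂ {n} {N}) (cycleVertices (TAdj G x y N) C)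
    ⊎ Σ (Path (Adj G) x y) (λ p₁ → Σ (Path (Adj G) x y) (λ p₂ →
        cycleLength (TAdj G x y N) C
          ≡ 6 * N + 4 + pathLength (Adj G) p₁ + pathLength (Adj G) p₂))
lemma6p3 N 1≤N n G _ x y x≢y _ _ _ no-3∣-path C 3∣len = Classification.classify G x y x≢y N C 1≤N no-3∣-path 3∣len
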